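{- Let $p$ be a bifix-free pattern of depth $0$ with dimensions $a\times c$, where $a\ge c\ge 1$ and $a\ge 2$. Then for all integers $m\ge n\ge 0$, the number of ballot paths from $(0,0)$ to $(n,m)$ avoiding $p$ equals $$(m-n+1)\sum_{i=0}^{\lfloor n/(a-1)\rfloor}\frac{(-1)^{i}}{m-ci+1}\binom{n-(a-1)i}{i}\binom{m+n-(a+c-1)i}{n-(a-1)i}$$ (terms with $ai>n$ vanish since then $\binom{n-(a-1)i}{i}=0$). In particular the number of such paths from $(0,0)$ to $(n,n)$ is $$\sum_{i=0}^{\lfloor n/(a-1)\rfloor}\frac{(-1)^{i}}{n-ci+1}\binom{n-(a-1)i}{i}\binom{2n-(a+c-1)i}{n-(a-1)i}.$$
   Context: A ballot path is a lattice path starting at $(0,0)$ with unit steps $u=(0,1)$, $r=(1,0)$, staying weakly above $y=x$. A pattern is a finite word over $\{u,r\}$; a path avoids $p$ if its step word has no block of consecutive steps equal to $p$. A pattern $p$ has dimensions $a\times c$ if it contains $a$ letters $r$ and $c$ letters $u$. The bifix index of $p$ is the number of distinct nonempty words $o$ such that $p=op'$ and $p=p''o$ for some words $p',p''$ (with $o\neq p$ implicitly, i.e. proper prefixes that are also suffixes); $p$ is bifix-free if its bifix index is $0$. For a word $w$ let $d(w)$ be the number of $u$'s minus the number of $r$'s in $w$. The depth of $p$ is $\max\{d(p')\,:\,p=qp' \text{ for some word } q\}$ (the maximum over all suffixes $p'$ of $p$, including the empty one). -}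

module Defs where

open import Data.Bool using (Bool; true; false; _∧_; not; if_then_else_)
open import Data.List using (List; []; _∷_; length; filterᵇ; take; drop; foldr; map; _++_; upTo; tails; inits)
open import Data.Bool.ListAction using (all; any)
open import Data.Nat as ℕ using (ℕ; zero; suc; _∸_; _≤ᵇ_; _≡ᵇ_)
open import Data.Nat.DivMod using (_/_)
open import Data.Nat.Combinatorics using (_C_)
open import Data.Integer as ℤ using (ℤ; +_; _⊔_)
open import Data.Rational as ℚ using (ℚ)
open import Relation.Nullary.Decidable using (⌊_⌋)

-- Steps: u = (0,1), r = (1,0)
data Step : Set where
  u r : Step

_==ˢ_ : Step → Step → Bool
u ==ˢ u = true
r ==ˢ r = true
_ ==ˢ _ = false

_==ʷ_ : List Step → List Step → Bool
[] ==ʷ [] = true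
(x ∷ xs) ==ʷ (y ∷ ys) = (x ==ˢ y) ∧ (xs ==ʷ ys)
_ ==ʷ _ = false

#u : List Step → ℕ
#u [] = 0
#u (u ∷ w) = suc (#u w)
#u (r ∷ w) = #u w

#r : List Step → ℕ
#r [] = 0
#r (r ∷ w) = suc (#r w)
#r (u ∷ w) = #r w

d : List Step → ℤ
d w = (+ #u w) ℤ.- (+ #r w)

words : ℕ → List (List Step)
words zero = [] ∷ []
words (suc k) = map (u ∷_) (words k) ++ map (r ∷_) (words k)

isBallot : List Step → Bool
isBallot w = all (λ q → #r q ≤ᵇ #u q) (inits w)

containsFactor : List Step → List Step → Bool
containsFactor p w = any (λ s → take (length p) s ==ʷ p) (tails w)

avoids : List Step → List Step → Bool
avoids w p = not (containsFactor p w)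

countPaths : List Step → ℕ → ℕ → ℕ
countPaths p n m =
  length (filterᵇ (λ w → ⌊ (#r w ℕ.≟ n) ⌋ ∧ ⌊ (#u w ℕ.≟ m) ⌋ ∧ isBallot w ∧ avoids w p)
                 (words (n ℕ.+ m)))

BifixFree : List Step → Set
BifixFree p = ∀ k → 1 ℕ.≤ k → k ℕ.< length p →
  (take k p ==ʷ drop (length p ∸ k) p) ≡ false
  where open import Relation.Binary.PropositionalEquality using (_≡_)

depth : List Step → ℤ
depth p = foldr (λ s acc → d s ⊔ acc) (+ 0) (tails p)

-- ⌊ n / (a - 1) ⌋ for a ≥ 2 (value irrelevant for a < 2)
floorDivPred : ℕ → ℕ → ℕ
floorDivPred n (suc (suc k)) = n / suc k
floorDivPred n _ = 0

sumTo : ℕ → (ℕ → ℚ) → ℚ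
sumTo N f = foldr (λ i acc → f i ℚ.+ acc) ℚ.0ℚ (upTo (suc N))

sgn : ℕ → ℤ
sgn zero = + 1
sgn (suc i) = ℤ.- sgn i

-- i-th summand: (-1)^i/(m-ci+1) * C(n-(a-1)i, i) * C(m+n-(a+c-1)i, n-(a-1)i);
-- terms with a*i > n are 0 (as stated in the paper); when a*i ≤ n ≤ m all
-- subtractions below are exact (c ≤ a) and m - c i + 1 ≥ 1.
term : ℕ → ℕ → ℕ → ℕ → ℕ → ℚ
term a c n m i =
  if a ℕ.* i ≤ᵇ n
  then (sgn i ℤ.* (+ (((n ∸ (a ∸ 1) ℕ.* i) C i) ℕ.* (((m ℕ.+ n) ∸ (a ℕ.+ c ∸ 1) ℕ.* i) C (n ∸ (a ∸ 1) ℕ.* i)))))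
         ℚ./ suc (m ∸ c ℕ.* i)
  else ℚ.0ℚ

formula : ℕ → ℕ → ℕ → ℕ → ℚ
formula a c n m = ((+ (m ∸ n ℕ.+ 1)) ℚ./ 1) ℚ.* sumTo (floorDivPred n a) (term a c n m)

formulaDiag : ℕ → ℕ → ℕ → ℚ
formulaDiag a c n = sumTo (floorDivPred n a) (term a c n n)

module Submission where

-- Both sides of the theorem are shown to satisfy the same
-- recurrence on the region n ≤ m, which determines them (Recurrence):
--   f(0,0) = 1,  f(k+1,k) = 0,
--   f(n,m+1) = f(n,m) + f(n-1,m+1) - [a ≤ n] f(n-a,m+1-c).
-- For the path counts (Words, PathCount) this classifies the paths ending at
-- (n,m+1) by their last step; the paths whose first occurrence of p is at the
-- end are subtracted, and they are exactly the admissible paths to (n-a,m+1-c)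
-- followed by p (bifix-free: no earlier occurrence is created; depth 0: the
-- ballot condition survives).
-- For the formula, the i-th summand is (-1)^i times a kernel in the shifted
-- coordinates x = n-(a-1)i, y = m-ci (Binomial, Kernel); the kernel satisfies a
-- three-term Pascal-type recurrence, which turns into the ballot recurrence for
-- the alternating sum (ClosedForm), and its closed form
-- (y+1)·kernel = (m-n+1)·C(x,i)·C(x+y,x) identifies the sum with the rational
-- formula of the statement (Formula).

module Binomial where

  open import Data.Nat as ℕ using (zero; suc)
  import Data.Nat.Properties as ℕP
  open import Data.Nat.Combinatorics using (_C_; nCk+nC[k+1]≡[n+1]C[k+1]; k>n⇒nCk≡0; nC1≡n)
  open import Data.Nat.Tactic.RingSolver as ℕSolver using ()
  open import Data.Integer as ℤ using (ℤ; +_; -[1+_]; _+_; _-_; _*_; 0ℤ; 1ℤ)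
  import Data.Integer.Properties as ℤP
  open import Data.Integer.Tactic.RingSolver using (solve-∀)
  open import Data.Product using (_×_; _,_)
  open import Data.Sum using (_⊎_; inj₁; inj₂)
  open import Data.Empty using (⊥-elim)
  open import Relation.Nullary using (¬_)
  open import Relation.Binary.PropositionalEquality

  binom : ℤ → ℤ → ℤ
  binom (+ n) (+ k) = + (n C k)
  binom (+ n) -[1+ k ] = 0ℤ
  binom -[1+ n ] _ = 0ℤ

  -- Identities over ℤ are proved as "ring identity + defect terms that vanish";
  -- this closes such a proof once the defect is known to be 0.
  drop-defect : ∀ {L R} (t : ℤ) → L ≡ R + t → t ≡ 0ℤ → L ≡ R
  drop-defect {L} {R} t L≡R+t t≡0 = trans L≡R+t (trans (cong (λ s → R + s) t≡0) (ℤP.+-identityʳ R))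

  defect : ∀ {x y : ℤ} → x ≡ y → x - y ≡ 0ℤ
  defect = ℤP.i≡j⇒i-j≡0

  product-zero : ∀ x y → x ≡ 0ℤ ⊎ y ≡ 0ℤ → x * y ≡ 0ℤ
  product-zero x y (inj₁ refl) = refl
  product-zero x y (inj₂ refl) = ℤP.*-zeroʳ x

  absorption-ℕ : ∀ n k → suc k ℕ.* (suc n C suc k) ≡ suc n ℕ.* (n C k)
  absorption-ℕ zero zero = refl
  absorption-ℕ zero (suc k)
    rewrite k>n⇒nCk≡0 {1} {suc (suc k)} (ℕ.s≤s (ℕ.s≤s ℕ.z≤n)) | k>n⇒nCk≡0 {0} {suc k} (ℕ.s≤s ℕ.z≤n)
    = ℕP.*-zeroʳ (suc (suc k))
  absorption-ℕ (suc n) zero rewrite nC1≡n (suc (suc n)) = ℕP.*-comm 1 (suc (suc n))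
  absorption-ℕ (suc n) (suc j) = begin
      suc (suc j) ℕ.* (suc (suc n) C suc (suc j))
        ≡⟨ cong (suc (suc j) ℕ.*_) (sym (nCk+nC[k+1]≡[n+1]C[k+1] (suc n) (suc j))) ⟩
      suc (suc j) ℕ.* (A ℕ.+ B)
        ≡⟨ spread A B j ⟩
      A ℕ.+ suc j ℕ.* A ℕ.+ suc (suc j) ℕ.* B
        ≡⟨ cong₂ (λ s t → A ℕ.+ s ℕ.+ t) (absorption-ℕ n j) (absorption-ℕ n (suc j)) ⟩
      A ℕ.+ suc n ℕ.* (n C j) ℕ.+ suc n ℕ.* (n C suc j)
        ≡⟨ collect A (n C j) (n C suc j) n ⟩
      A ℕ.+ suc n ℕ.* ((n C j) ℕ.+ (n C suc j))
        ≡⟨ cong (λ s → A ℕ.+ suc n ℕ.* s) (nCk+nC[k+1]≡[n+1]C[k+1] n j) ⟩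
      A ℕ.+ suc n ℕ.* A
        ∎
    where
    open ≡-Reasoning
    A = suc n C suc j
    B = suc n C suc (suc j)
    spread : ∀ a b j → suc (suc j) ℕ.* (a ℕ.+ b) ≡ a ℕ.+ suc j ℕ.* a ℕ.+ suc (suc j) ℕ.* b
    spread = ℕSolver.solve-∀
    collect : ∀ a b c n → a ℕ.+ suc n ℕ.* b ℕ.+ suc n ℕ.* c ≡ a ℕ.+ suc n ℕ.* (b ℕ.+ c)
    collect = ℕSolver.solve-∀

  pascal : ∀ N K → 1ℤ ℤ.≤ N → binom N K ≡ binom (N - 1ℤ) (K - 1ℤ) + binom (N - 1ℤ) K
  pascal (+ suc n) (+ zero) _ = refl
  pascal (+ suc n) (+ suc k) _ = cong +_ (sym (nCk+nC[k+1]≡[n+1]C[k+1] n k))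
  pascal (+ suc n) -[1+ k ] _ = refl
  pascal (+ zero) K (ℤ.+≤+ ())

  absorption : ∀ N K → K * binom N K ≡ N * binom (N - 1ℤ) (K - 1ℤ)
  absorption -[1+ n ] K = trans (ℤP.*-zeroʳ K) (sym (ℤP.*-zeroʳ -[1+ n ]))
  absorption (+ zero) (+ zero) = refl
  absorption (+ zero) (+ suc k) rewrite k>n⇒nCk≡0 {0} {suc k} (ℕ.s≤s ℕ.z≤n) = ℤP.*-zeroʳ (+ suc k)
  absorption (+ zero) -[1+ k ] = ℤP.*-zeroʳ -[1+ k ]
  absorption (+ suc n) (+ zero) = sym (ℤP.*-zeroʳ (+ suc n))
  absorption (+ suc n) (+ suc k) =
    trans (sym (ℤP.pos-* (suc k) _)) (trans (cong +_ (absorption-ℕ n k)) (ℤP.pos-* (suc n) _))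
  absorption (+ suc n) -[1+ k ] = trans (ℤP.*-zeroʳ -[1+ k ]) (sym (ℤP.*-zeroʳ (+ suc n)))

  -- The ratio of neighbouring entries of a row: K·C(N,K) = (N-K+1)·C(N,K-1).
  -- For N ≥ 1 it follows from absorption (twice) and Pascal's rule.
  row-ratio : ∀ N K → K * binom N K ≡ (N - K + 1ℤ) * binom N (K - 1ℤ)
  row-ratio -[1+ n ] K = trans (ℤP.*-zeroʳ K) (sym (ℤP.*-zeroʳ (-[1+ n ] - K + 1ℤ)))
  row-ratio (+ zero) (+ zero) = refl
  row-ratio (+ zero) (+ suc zero) = refl
  row-ratio (+ zero) (+ suc (suc k))
    rewrite k>n⇒nCk≡0 {0} {suc (suc k)} (ℕ.s≤s ℕ.z≤n) | k>n⇒nCk≡0 {0} {suc k} (ℕ.s≤s ℕ.z≤n)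
    = trans (ℤP.*-zeroʳ (+ suc (suc k))) (sym (ℤP.*-zeroʳ (0ℤ - + suc (suc k) + 1ℤ)))
  row-ratio (+ zero) -[1+ k ] = trans (ℤP.*-zeroʳ -[1+ k ]) (sym (ℤP.*-zeroʳ (0ℤ - -[1+ k ] + 1ℤ)))
  row-ratio (+ suc n) K =
    drop-defect _ (identity K N (binom N K) (binom N (K - 1ℤ)) (binom (N - 1ℤ) (K - 1ℤ - 1ℤ)) (binom (N - 1ℤ) (K - 1ℤ)))
      (vanish (defect (absorption N K)) (defect (pascal N (K - 1ℤ) (ℤ.+≤+ (ℕ.s≤s ℕ.z≤n)))) (defect (absorption N (K - 1ℤ))))
    where
    N = + suc n
    identity : ∀ K N X P Q R →
      K * X ≡ (N - K + 1ℤ) * P + ((K * X - N * R) - N * (P - (Q + R)) + ((K - 1ℤ) * P - N * Q))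
    identity = solve-∀
    vanish : ∀ {s t v} → s ≡ 0ℤ → t ≡ 0ℤ → v ≡ 0ℤ → s - N * t + v ≡ 0ℤ
    vanish refl refl refl rewrite ℤP.*-zeroʳ N = refl

  binom-negative : ∀ N k → binom N -[1+ k ] ≡ 0ℤ
  binom-negative (+ n) k = refl
  binom-negative -[1+ n ] k = refl

  binom-above : ∀ N K → N ℤ.< K → binom N K ≡ 0ℤ
  binom-above (+ n) (+ k) (ℤ.+<+ n<k) = cong +_ (k>n⇒nCk≡0 n<k)
  binom-above -[1+ n ] K _ = refl

  binom-support : ∀ N K → ¬ binom N K ≡ 0ℤ → 0ℤ ℤ.≤ K × K ℤ.≤ N
  binom-support (+ n) (+ k) ≢0 with ℕP.≤-<-connex k n
  ... | inj₁ k≤n = ℤ.+≤+ ℕ.z≤n , ℤ.+≤+ k≤n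
  ... | inj₂ n<k = ⊥-elim (≢0 (cong +_ (k>n⇒nCk≡0 n<k)))
  binom-support (+ n) -[1+ k ] ≢0 = ⊥-elim (≢0 refl)
  binom-support -[1+ n ] K ≢0 = ⊥-elim (≢0 refl)

module Kernel where

  open Binomial
  open import Data.Nat as ℕ using (zero; suc)
  import Data.Nat.Properties as ℕP
  open import Data.Nat.Combinatorics using (k>n⇒nCk≡0; nCn≡1)
  open import Data.Integer as ℤ using (ℤ; +_; -[1+_]; _+_; _-_; _*_; 0ℤ; 1ℤ)
  import Data.Integer.Properties as ℤP
  open import Data.Integer.Tactic.RingSolver using (solve-∀)
  open import Data.Product using (_,_)
  open import Data.Sum using (_⊎_; inj₁; inj₂)
  open import Relation.Nullary using (¬_; yes; no)
  open import Relation.Binary.PropositionalEquality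

  -- For i = 0 it is the ballot number from (0,0) to (x,y); the i-th summand of
  -- the theorem is, up to sign, the kernel at (x,y) = (n-(a-1)i, m-ci), e = a-c-1.
  kernel : ℤ → ℤ → ℤ → ℤ → ℤ
  kernel e i x y =
    binom x i * (binom (x + y) x - binom (x + y) (x - 1ℤ)) - e * (binom (x - 1ℤ) (i - 1ℤ) * binom (x + y) (x - 1ℤ))

  pascal-defect : ℤ → ℤ → ℤ
  pascal-defect N K = binom N K - (binom (N - 1ℤ) (K - 1ℤ) + binom (N - 1ℤ) K)

  pascal-defect-zero : ∀ N K → 1ℤ ℤ.≤ N → pascal-defect N K ≡ 0ℤ
  pascal-defect-zero N K 1≤N = defect (pascal N K 1≤N)

  -- The three Pascal defects occurring in the kernel recurrence vanish,
  -- possibly only after multiplication by the coefficient they come with.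
  row-defect-vanishes : ∀ x i M →
    pascal-defect x i * (binom M (x - 1ℤ) - binom M (x - 1ℤ - 1ℤ)) ≡ 0ℤ
  row-defect-vanishes x i M = product-zero _ _ (cases x)
    where
    cases : ∀ x → pascal-defect x i ≡ 0ℤ ⊎ binom M (x - 1ℤ) - binom M (x - 1ℤ - 1ℤ) ≡ 0ℤ
    cases (+ suc n) = inj₁ (pascal-defect-zero (+ suc n) i (ℤ.+≤+ (ℕ.s≤s ℕ.z≤n)))
    cases (+ zero) rewrite binom-negative M 0 | binom-negative M 1 = inj₂ refl
    cases -[1+ n ] rewrite binom-negative M (suc (n ℕ.+ 0)) | binom-negative M (suc (suc (n ℕ.+ 0) ℕ.+ 0)) = inj₂ refl

  shifted-row-defect-vanishes : ∀ x i M →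
    pascal-defect (x - 1ℤ) (i - 1ℤ) * binom M (x - 1ℤ - 1ℤ) ≡ 0ℤ
  shifted-row-defect-vanishes x i M = product-zero _ _ (cases x)
    where
    cases : ∀ x → pascal-defect (x - 1ℤ) (i - 1ℤ) ≡ 0ℤ ⊎ binom M (x - 1ℤ - 1ℤ) ≡ 0ℤ
    cases (+ suc (suc n)) = inj₁ (pascal-defect-zero (+ suc n) (i - 1ℤ) (ℤ.+≤+ (ℕ.s≤s ℕ.z≤n)))
    cases (+ suc zero) = inj₂ (binom-negative M 0)
    cases (+ zero) = inj₂ (binom-negative M 1)
    cases -[1+ n ] = inj₂ (binom-negative M (suc (suc (n ℕ.+ 0) ℕ.+ 0)))

  weighted-defect-vanishes : ∀ w N K → (¬ w ≡ 0ℤ → 1ℤ ℤ.≤ N) → w * pascal-defect N K ≡ 0ℤ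
  weighted-defect-vanishes w N K w≢0⇒1≤N with w ℤ.≟ 0ℤ
  ... | yes refl = refl
  ... | no w≢0 rewrite pascal-defect-zero N K (w≢0⇒1≤N w≢0) = ℤP.*-zeroʳ w

  shift-x : ∀ x y → (x - 1ℤ) + y ≡ (x + y) - 1ℤ
  shift-x = solve-∀

  shift-y : ∀ x y → x + (y - 1ℤ) ≡ (x + y) - 1ℤ
  shift-y = solve-∀

  -- It needs x + y ≥ 1 only where the coefficients C(x,i), C(x-1,i-1)
  -- can be nonzero, i.e. for 0 ≤ i ≤ x.
  kernel-recurrence : ∀ e i x y → (0ℤ ℤ.≤ i → i ℤ.≤ x → 1ℤ ℤ.≤ x + y) →
    kernel e i x y ≡ kernel e i (x - 1ℤ) y + kernel e i x (y - 1ℤ) + kernel e (i - 1ℤ) (x - 1ℤ) y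
  kernel-recurrence e i x y support rewrite shift-x x y | shift-y x y =
    drop-defect _
      (identity e (binom x i) (binom (x - 1ℤ) i) (binom (x - 1ℤ) (i - 1ℤ))
                (binom (x - 1ℤ - 1ℤ) (i - 1ℤ)) (binom (x - 1ℤ - 1ℤ) (i - 1ℤ - 1ℤ))
                (binom N x) (binom N (x - 1ℤ)) (binom (N - 1ℤ) x)
                (binom (N - 1ℤ) (x - 1ℤ)) (binom (N - 1ℤ) (x - 1ℤ - 1ℤ)))
      (vanish (row-defect-vanishes x i (N - 1ℤ))
              (weighted-defect-vanishes (binom x i) N x 1≤N₁)
              (weighted-defect-vanishes (binom x i) N (x - 1ℤ) 1≤N₁)
              (weighted-defect-vanishes (binom (x - 1ℤ) (i - 1ℤ)) N (x - 1ℤ) 1≤N₂)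
              (shifted-row-defect-vanishes x i (N - 1ℤ)))
    where
    N = x + y
    identity : ∀ e c₁ c₂ c₃ c₄ c₅ b₁ b₂ b₃ b₄ b₅ →
      c₁ * (b₁ - b₂) - e * (c₃ * b₂) ≡
      (c₂ * (b₄ - b₅) - e * (c₄ * b₅)) + (c₁ * (b₃ - b₄) - e * (c₃ * b₄)) + (c₃ * (b₄ - b₅) - e * (c₅ * b₅)) +
      ((c₁ - (c₃ + c₂)) * (b₄ - b₅) + c₁ * (b₁ - (b₄ + b₃)) - c₁ * (b₂ - (b₅ + b₄))
        - e * (c₃ * (b₂ - (b₅ + b₄)) + (c₃ - (c₅ + c₄)) * b₅))
    identity = solve-∀
    vanish : ∀ {s t v w z} → s ≡ 0ℤ → t ≡ 0ℤ → v ≡ 0ℤ → w ≡ 0ℤ → z ≡ 0ℤ → s + t - v - e * (w + z) ≡ 0ℤ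
    vanish refl refl refl refl refl rewrite ℤP.*-zeroʳ e = refl
    1≤N₁ : ¬ binom x i ≡ 0ℤ → 1ℤ ℤ.≤ N
    1≤N₁ ≢0 with binom-support x i ≢0
    ... | 0≤i , i≤x = support 0≤i i≤x
    1≤N₂ : ¬ binom (x - 1ℤ) (i - 1ℤ) ≡ 0ℤ → 1ℤ ℤ.≤ N
    1≤N₂ ≢0 with binom-support (x - 1ℤ) (i - 1ℤ) ≢0
    ... | 0≤i-1 , i-1≤x-1 = support (ℤP.≤-trans 0≤i-1 (ℤP.i≤j⇒i-k≤j 1ℤ ℤP.≤-refl)) (subst₂ ℤ._≤_ (pred-suc i) (pred-suc x) (ℤP.+-monoˡ-≤ 1ℤ i-1≤x-1))
      where
      pred-suc : ∀ z → z - 1ℤ + 1ℤ ≡ z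
      pred-suc = solve-∀

  kernel-closed-form : ∀ e i x y → (y + 1ℤ) * kernel e i x y ≡ (y - x + 1ℤ - e * i) * binom x i * binom (x + y) x
  kernel-closed-form e i x y =
    drop-defect _ (identity e i x y (binom x i) (binom (x - 1ℤ) (i - 1ℤ)) (binom (x + y) x) (binom (x + y) (x - 1ℤ)))
      (vanish (binom x i) (binom (x + y) x) (binom (x - 1ℤ) (i - 1ℤ)) (defect (row-ratio (x + y) x)) (defect (absorption x i)))
    where
    identity : ∀ e i x y c₁ c₃ b₁ b₂ →
      (y + 1ℤ) * (c₁ * (b₁ - b₂) - e * (c₃ * b₂)) ≡
      (y - x + 1ℤ - e * i) * c₁ * b₁ +
      (c₁ * (x * b₁ - ((x + y) - x + 1ℤ) * b₂) + e * (b₁ * (i * c₁ - x * c₃) + c₃ * (x * b₁ - ((x + y) - x + 1ℤ) * b₂)))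
    identity = solve-∀
    vanish : ∀ {s t} (c₁ b₁ c₃ : ℤ) → s ≡ 0ℤ → t ≡ 0ℤ → c₁ * s + e * (b₁ * t + c₃ * s) ≡ 0ℤ
    vanish c₁ b₁ c₃ refl refl rewrite ℤP.*-zeroʳ c₁ | ℤP.*-zeroʳ b₁ | ℤP.*-zeroʳ c₃ | ℤP.*-zeroʳ e = refl

  kernel-negative-index : ∀ e k x y → kernel e -[1+ k ] x y ≡ 0ℤ
  kernel-negative-index e k x y
    rewrite binom-negative x k | binom-negative (x - 1ℤ) (suc (k ℕ.+ 0)) | ℤP.*-zeroˡ (binom (x + y) (x - 1ℤ)) | ℤP.*-zeroʳ e
    = refl

  kernel-vanishes : ∀ e i x y → binom x i ≡ 0ℤ → binom (x - 1ℤ) (i - 1ℤ) ≡ 0ℤ → kernel e i x y ≡ 0ℤ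
  kernel-vanishes e i x y c₁≡0 c₂≡0
    rewrite c₁≡0 | c₂≡0 | ℤP.*-zeroˡ (binom (x + y) (x - 1ℤ)) | ℤP.*-zeroʳ e
    = refl

  -- The one point with y = -1 where the closed form cannot be divided by y + 1.
  kernel-corner : ∀ j → kernel -[1+ 0 ] (+ suc j) (+ suc j) -[1+ 0 ] ≡ 0ℤ
  kernel-corner j rewrite nCn≡1 (suc j) | nCn≡1 j | k>n⇒nCk≡0 {j} {suc j} (ℕP.n<1+n j) = refl

module Recurrence where

  open import Data.Nat using (ℕ; zero; suc; _+_; _∸_; _≤_; _<_; s≤s; _≤?_)
  import Data.Nat.Properties as ℕP
  open import Data.Integer as ℤ using (ℤ; 0ℤ; 1ℤ)
  open import Relation.Nullary using (yes; no)
  open import Relation.Binary.PropositionalEquality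

  left : (ℕ → ℕ → ℤ) → ℕ → ℕ → ℤ
  left f zero m = 0ℤ
  left f (suc n) m = f n m

  -- The recurrence shared by the path counts and the closed formula, for a
  -- pattern with a right steps and c up steps: a path to (n,m+1) ends with u
  -- (coming from (n,m)) or with r (coming from (n-1,m+1)), and the paths whose
  -- last a+c steps form the pattern, which start at (n-a,m+1-c), are removed.
  record BallotRecurrence (a c : ℕ) (f : ℕ → ℕ → ℤ) : Set where
    field
      origin : f 0 0 ≡ 1ℤ
      below-diagonal : ∀ k → f (suc k) k ≡ 0ℤ
      step-short : ∀ n m → n ≤ suc m → n < a →
        f n (suc m) ≡ f n m ℤ.+ left f n (suc m)
      step-long : ∀ n m → n ≤ suc m → a ≤ n →
        f n (suc m) ≡ f n m ℤ.+ left f n (suc m) ℤ.- f (n ∸ a) (suc m ∸ c)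

  -- The recurrence determines f on the region n ≤ m (when 1 ≤ a and c ≤ a, so
  -- that the long step stays in the region and decreases n + m).
  recurrence-unique : ∀ {a c f g} → 1 ≤ a → c ≤ a →
    BallotRecurrence a c f → BallotRecurrence a c g → ∀ n m → n ≤ m → f n m ≡ g n m
  recurrence-unique {a} {c} {f} {g} 1≤a c≤a F G n m n≤m = go (suc (n + m)) n m (ℕP.n<1+n (n + m)) n≤m
    where
    module F = BallotRecurrence F
    module G = BallotRecurrence G

    go : ∀ K n m → n + m < K → n ≤ m → f n m ≡ g n m
    near : ∀ K n m → n ≤ suc m → n + m < K → f n m ≡ g n m
    to-the-left : ∀ K n m → n ≤ suc m → n + suc m ≤ K → left f n (suc m) ≡ left g n (suc m)

    go (suc K) zero zero _ _ = trans F.origin (sym G.origin)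
    go (suc K) (suc n) zero _ ()
    go (suc K) n (suc m) (s≤s bound) n≤m+1 with a ≤? n
    ... | no n≱a = begin
        f n (suc m)                   ≡⟨ F.step-short n m n≤m+1 (ℕP.≰⇒> n≱a) ⟩
        f n m ℤ.+ left f n (suc m)    ≡⟨ cong₂ ℤ._+_ (near K n m n≤m+1 n+m<K) (to-the-left K n m n≤m+1 bound) ⟩
        g n m ℤ.+ left g n (suc m)    ≡⟨ sym (G.step-short n m n≤m+1 (ℕP.≰⇒> n≱a)) ⟩
        g n (suc m)                   ∎
      where
      open ≡-Reasoning
      n+m<K : n + m < K
      n+m<K = ℕP.<-≤-trans (ℕP.+-monoʳ-< n (ℕP.n<1+n m)) bound
    ... | yes a≤n = begin
        f n (suc m)                                          ≡⟨ F.step-long n m n≤m+1 a≤n ⟩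
        f n m ℤ.+ left f n (suc m) ℤ.- f (n ∸ a) (suc m ∸ c)
          ≡⟨ cong₂ ℤ._-_ (cong₂ ℤ._+_ (near K n m n≤m+1 n+m<K) (to-the-left K n m n≤m+1 bound)) shifted ⟩
        g n m ℤ.+ left g n (suc m) ℤ.- g (n ∸ a) (suc m ∸ c)  ≡⟨ sym (G.step-long n m n≤m+1 a≤n) ⟩
        g n (suc m)                                          ∎
      where
      open ≡-Reasoning
      n+m<K : n + m < K
      n+m<K = ℕP.<-≤-trans (ℕP.+-monoʳ-< n (ℕP.n<1+n m)) bound
      shifted : f (n ∸ a) (suc m ∸ c) ≡ g (n ∸ a) (suc m ∸ c)
      shifted = go K (n ∸ a) (suc m ∸ c)
        (ℕP.<-≤-trans (ℕP.+-mono-<-≤ (ℕP.∸-monoʳ-< {n} {a} {0} 1≤a a≤n) (ℕP.m∸n≤m (suc m) c)) bound)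
        (ℕP.≤-trans (ℕP.∸-monoˡ-≤ a n≤m+1) (ℕP.∸-monoʳ-≤ (suc m) c≤a))

    near K n m n≤m+1 n+m<K with n ≤? m
    ... | yes n≤m = go K n m n+m<K n≤m
    ... | no n≰m rewrite ℕP.≤-antisym n≤m+1 (ℕP.≰⇒> n≰m) = trans (F.below-diagonal m) (sym (G.below-diagonal m))

    to-the-left K zero m _ _ = refl
    to-the-left K (suc n) m n+1≤m+1 bound =
      go K n (suc m) (ℕP.<-≤-trans (ℕP.n<1+n (n + suc m)) bound) (ℕP.≤-trans (ℕP.n≤1+n n) n+1≤m+1)

module ClosedForm where

  open Binomial
  open Kernel
  open Recurrence
  open import Defs using (sgn)
  open import Data.Nat as ℕ using (ℕ; zero; suc)
  import Data.Nat.Properties as ℕP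
  open import Data.Integer as ℤ using (ℤ; +_; -[1+_]; _+_; _-_; _*_; -_; 0ℤ; 1ℤ)
  import Data.Integer.Properties as ℤP
  open import Data.Integer.Tactic.RingSolver using (solve-∀)
  open import Data.Empty using (⊥-elim)
  open import Data.Sum using (_⊎_; inj₁; inj₂)
  open import Relation.Binary.PropositionalEquality

  sumℤ : ℕ → (ℕ → ℤ) → ℤ
  sumℤ zero f = 0ℤ
  sumℤ (suc B) f = f 0 + sumℤ B (λ i → f (suc i))

  sumℤ-cong : ∀ B {f g} → (∀ i → f i ≡ g i) → sumℤ B f ≡ sumℤ B g
  sumℤ-cong zero f≗g = refl
  sumℤ-cong (suc B) f≗g = cong₂ _+_ (f≗g 0) (sumℤ-cong B (λ i → f≗g (suc i)))

  sumℤ-+ : ∀ B f g → sumℤ B (λ i → f i + g i) ≡ sumℤ B f + sumℤ B g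
  sumℤ-+ zero f g = refl
  sumℤ-+ (suc B) f g rewrite sumℤ-+ B (λ i → f (suc i)) (λ i → g (suc i)) =
    interchange (f 0) (g 0) (sumℤ B (λ i → f (suc i))) (sumℤ B (λ i → g (suc i)))
    where
    interchange : ∀ a b c d → a + b + (c + d) ≡ a + c + (b + d)
    interchange = solve-∀

  sumℤ-neg : ∀ B f → sumℤ B (λ i → - f i) ≡ - sumℤ B f
  sumℤ-neg zero f = refl
  sumℤ-neg (suc B) f rewrite sumℤ-neg B (λ i → f (suc i)) = sym (ℤP.neg-distrib-+ (f 0) _)

  sumℤ-zero : ∀ B f → (∀ i → f i ≡ 0ℤ) → sumℤ B f ≡ 0ℤ
  sumℤ-zero zero f f≡0 = refl
  sumℤ-zero (suc B) f f≡0 rewrite f≡0 0 = trans (ℤP.+-identityˡ _) (sumℤ-zero B (λ i → f (suc i)) (λ i → f≡0 (suc i)))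

  sumℤ-truncate : ∀ B k f → (∀ i → B ℕ.≤ i → f i ≡ 0ℤ) → sumℤ (B ℕ.+ k) f ≡ sumℤ B f
  sumℤ-truncate zero k f f≡0 = sumℤ-zero k f (λ i → f≡0 i ℕ.z≤n)
  sumℤ-truncate (suc B) k f f≡0 =
    cong (λ s → f 0 + s) (sumℤ-truncate B k (λ i → f (suc i)) (λ i B≤i → f≡0 (suc i) (ℕ.s≤s B≤i)))

  pos-∸ : ∀ n m → m ℕ.≤ n → + n - + m ≡ + (n ℕ.∸ m)
  pos-∸ n m m≤n = trans (ℤP.m-n≡m⊖n n m) (ℤP.⊖-≥ m≤n)

  module AlternatingSum (a c : ℕ) where

    e : ℤ
    e = + a - + c - 1ℤ

    X : ℕ → ℤ → ℤ
    X i n = n - (+ a - 1ℤ) * + i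
    Y : ℕ → ℤ → ℤ
    Y i m = m - + c * + i

    summand : ℕ → ℤ → ℤ → ℤ
    summand i n m = kernel e (+ i) (X i n) (Y i m)

    altSum : ℕ → ℤ → ℤ → ℤ
    altSum B n m = sumℤ B (λ i → sgn i * summand i n m)

    -- Σ_{i ≤ n} (-1)^i summand i n m; all later summands vanish.
    closedForm : ℕ → ℕ → ℤ
    closedForm n m = altSum (suc n) (+ n) (+ m)

    Support : ℕ → ℤ → ℤ → Set
    Support i n m = 0ℤ ℤ.≤ + i → + i ℤ.≤ X i n → 1ℤ ℤ.≤ X i n + Y i m

    summand-recurrence : ∀ j n m → Support (suc j) n m →
      summand (suc j) n m ≡ summand (suc j) (n - 1ℤ) m + summand (suc j) n (m - 1ℤ) + summand j (n - + a) (m - + c)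
    summand-recurrence j n m supp = trans (kernel-recurrence e (+ suc j) (X (suc j) n) (Y (suc j) m) supp)
      (cong₂ _+_ (cong₂ _+_ (cong (λ x → kernel e (+ suc j) x (Y (suc j) m)) (shift-n (+ a) n (+ suc j)))
                            (cong (kernel e (+ suc j) (X (suc j) n)) (shift-m (+ c) m (+ suc j))))
                 (cong₂ (kernel e (+ j)) (shift-a (+ a) n (+ j)) (shift-c (+ c) m (+ j))))
      where
      shift-n : ∀ a n i → (n - (a - 1ℤ) * i) - 1ℤ ≡ (n - 1ℤ) - (a - 1ℤ) * i
      shift-n = solve-∀
      shift-m : ∀ c m i → (m - c * i) - 1ℤ ≡ (m - 1ℤ) - c * i
      shift-m = solve-∀
      shift-a : ∀ a n j → (n - (a - 1ℤ) * (1ℤ + j)) - 1ℤ ≡ (n - a) - (a - 1ℤ) * j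
      shift-a = solve-∀
      shift-c : ∀ c m j → m - c * (1ℤ + j) ≡ (m - c) - c * j
      shift-c = solve-∀

    summand₀-recurrence : ∀ n m → Support 0 n m → summand 0 n m ≡ summand 0 (n - 1ℤ) m + summand 0 n (m - 1ℤ)
    summand₀-recurrence n m supp = begin
        summand 0 n m
          ≡⟨ kernel-recurrence e 0ℤ (X 0 n) (Y 0 m) supp ⟩
        kernel e 0ℤ (X 0 n - 1ℤ) (Y 0 m) + kernel e 0ℤ (X 0 n) (Y 0 m - 1ℤ) + kernel e -[1+ 0 ] (X 0 n - 1ℤ) (Y 0 m)
          ≡⟨ cong (λ s → kernel e 0ℤ (X 0 n - 1ℤ) (Y 0 m) + kernel e 0ℤ (X 0 n) (Y 0 m - 1ℤ) + s) (kernel-negative-index e 0 (X 0 n - 1ℤ) (Y 0 m)) ⟩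
        kernel e 0ℤ (X 0 n - 1ℤ) (Y 0 m) + kernel e 0ℤ (X 0 n) (Y 0 m - 1ℤ) + 0ℤ
          ≡⟨ ℤP.+-identityʳ _ ⟩
        kernel e 0ℤ (X 0 n - 1ℤ) (Y 0 m) + kernel e 0ℤ (X 0 n) (Y 0 m - 1ℤ)
          ≡⟨ cong₂ _+_ (cong (λ x → kernel e 0ℤ x (Y 0 m)) (shift-n n)) (cong (kernel e 0ℤ (X 0 n)) (shift-m m)) ⟩
        summand 0 (n - 1ℤ) m + summand 0 n (m - 1ℤ)
          ∎
      where
      open ≡-Reasoning
      shift : ∀ k n → (n - k * 0ℤ) - 1ℤ ≡ (n - 1ℤ) - k * 0ℤ
      shift = solve-∀
      shift-n : ∀ n → (n - (+ a - 1ℤ) * 0ℤ) - 1ℤ ≡ (n - 1ℤ) - (+ a - 1ℤ) * 0ℤ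
      shift-n = shift (+ a - 1ℤ)
      shift-m : ∀ m → (m - + c * 0ℤ) - 1ℤ ≡ (m - 1ℤ) - + c * 0ℤ
      shift-m = shift (+ c)

    summand-vanishes : ∀ i n m → n ℤ.< + a * + i → summand i n m ≡ 0ℤ
    summand-vanishes i n m n<ai =
      kernel-vanishes e (+ i) (X i n) (Y i m) (binom-above _ _ x<i) (binom-above _ _ (ℤP.+-monoˡ-< (- 1ℤ) x<i))
      where
      split : ∀ a i → i ≡ a * i - (a - 1ℤ) * i
      split = solve-∀
      x<i : X i n ℤ.< + i
      x<i = subst (X i n ℤ.<_) (sym (split (+ a) (+ i))) (ℤP.+-monoˡ-< (- ((+ a - 1ℤ) * + i)) n<ai)

    -- The alternating sum inherits the recurrence with the pattern step (a,c):
    -- the i-th summand feeds the (i+1)-st through its third term, with the sign flipped.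
    altSum-recurrence : ∀ B n m → (∀ i → Support i n m) →
      altSum (suc B) n m ≡ altSum (suc B) (n - 1ℤ) m + altSum (suc B) n (m - 1ℤ) - altSum B (n - + a) (m - + c)
    altSum-recurrence B n m supp = begin
        1ℤ * summand 0 n m + sumℤ B (λ j → (- sgn j) * summand (suc j) n m)
          ≡⟨ cong₂ (λ s t → 1ℤ * s + t) (summand₀-recurrence n m (supp 0))
               (sumℤ-cong B (λ j → trans (cong ((- sgn j) *_) (summand-recurrence j n m (supp (suc j)))) (distribute (sgn j) _ _ _))) ⟩
        1ℤ * (P₀ + Q₀) + sumℤ B (λ j → ((- sgn j) * P j + (- sgn j) * Q j) + - (sgn j * R j))
          ≡⟨ cong (λ s → 1ℤ * (P₀ + Q₀) + s) (trans (sumℤ-+ B _ _) (cong₂ _+_ (sumℤ-+ B _ _) (sumℤ-neg B _))) ⟩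
        1ℤ * (P₀ + Q₀) + ((sumℤ B (λ j → (- sgn j) * P j) + sumℤ B (λ j → (- sgn j) * Q j)) + - altSum B (n - + a) (m - + c))
          ≡⟨ regroup P₀ Q₀ (sumℤ B (λ j → (- sgn j) * P j)) (sumℤ B (λ j → (- sgn j) * Q j)) (altSum B (n - + a) (m - + c)) ⟩
        altSum (suc B) (n - 1ℤ) m + altSum (suc B) n (m - 1ℤ) - altSum B (n - + a) (m - + c)
          ∎
      where
      open ≡-Reasoning
      P₀ = summand 0 (n - 1ℤ) m
      Q₀ = summand 0 n (m - 1ℤ)
      P Q R : ℕ → ℤ
      P j = summand (suc j) (n - 1ℤ) m
      Q j = summand (suc j) n (m - 1ℤ)
      R j = summand j (n - + a) (m - + c)
      distribute : ∀ s p q r → (- s) * (p + q + r) ≡ ((- s) * p + (- s) * q) + - (s * r)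
      distribute = solve-∀
      regroup : ∀ p q sp sq sr → 1ℤ * (p + q) + ((sp + sq) + - sr) ≡ (1ℤ * p + sp) + (1ℤ * q + sq) - sr
      regroup = solve-∀

    support : ∀ i n m → c ℕ.≤ a → n ℕ.≤ m → 1 ℕ.≤ m → Support i (+ n) (+ m)
    support i n m c≤a n≤m 1≤m _ i≤X = subst (1ℤ ℤ.≤_) (sym (sum-XY (+ a) (+ c) (+ i) (+ n) (+ m))) (move-right {q = + a * + i + + c * + i} lower)
      where
      sum-XY : ∀ a c i n m → (n - (a - 1ℤ) * i) + (m - c * i) ≡ (n + m + i) - (a * i + c * i)
      sum-XY = solve-∀
      add-back : ∀ a i n → (n - (a - 1ℤ) * i) + (a - 1ℤ) * i ≡ n
      add-back = solve-∀
      collect : ∀ a i → i + (a - 1ℤ) * i ≡ a * i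
      collect = solve-∀
      move-right : ∀ {p q r} → p + q ℤ.≤ r → p ℤ.≤ r - q
      move-right {p} {q} {r} p+q≤r = subst (ℤ._≤ r - q) (cancel p q) (ℤP.+-monoˡ-≤ (- q) p+q≤r)
        where
        cancel : ∀ p q → p + q - q ≡ p
        cancel = solve-∀
      ai≤n : a ℕ.* i ℕ.≤ n
      ai≤n = ℤP.drop‿+≤+ (subst₂ ℤ._≤_ (trans (collect (+ a) (+ i)) (sym (ℤP.pos-* a i))) (add-back (+ a) (+ i) (+ n))
                                       (ℤP.+-monoˡ-≤ ((+ a - 1ℤ) * + i) i≤X))
      in-ℕ : ∀ i → a ℕ.* i ℕ.≤ n → 1 ℕ.+ (a ℕ.* i ℕ.+ c ℕ.* i) ℕ.≤ n ℕ.+ m ℕ.+ i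
      in-ℕ zero _ rewrite ℕP.*-zeroʳ a | ℕP.*-zeroʳ c | ℕP.+-identityʳ (n ℕ.+ m) = ℕP.≤-trans 1≤m (ℕP.m≤n+m m n)
      in-ℕ (suc k) ai≤n =
        ℕP.≤-trans (ℕ.s≤s (ℕP.+-mono-≤ ai≤n (ℕP.≤-trans (ℕP.*-monoˡ-≤ (suc k) c≤a) (ℕP.≤-trans ai≤n n≤m))))
          (subst (ℕ._≤ n ℕ.+ m ℕ.+ suc k) (ℕP.+-comm (n ℕ.+ m) 1) (ℕP.+-monoʳ-≤ (n ℕ.+ m) (ℕ.s≤s ℕ.z≤n)))
      lower : 1ℤ + (+ a * + i + + c * + i) ℤ.≤ + n + + m + + i
      lower rewrite sym (ℤP.pos-* a i) | sym (ℤP.pos-* c i) = ℤ.+≤+ (in-ℕ i ai≤n)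

    altSum-stable : ∀ B₀ B n m → B₀ ℕ.≤ B → (∀ i → B₀ ℕ.≤ i → n ℤ.< + a * + i) → altSum B n m ≡ altSum B₀ n m
    altSum-stable B₀ B n m B₀≤B beyond = trans (cong (λ k → altSum k n m) (sym (ℕP.m+[n∸m]≡n B₀≤B)))
      (sumℤ-truncate B₀ (B ℕ.∸ B₀) _
        (λ i B₀≤i → trans (cong (sgn i *_) (summand-vanishes i n m (beyond i B₀≤i))) (ℤP.*-zeroʳ (sgn i))))

    altSum-truncate : ∀ n m B → 1 ℕ.≤ a → suc n ℕ.≤ B → altSum B (+ n) m ≡ altSum (suc n) (+ n) m
    altSum-truncate n m B 1≤a n<B = altSum-stable (suc n) B (+ n) m n<B n<ai
      where
      n<ai : ∀ i → suc n ℕ.≤ i → + n ℤ.< + a * + i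
      n<ai i n<i = subst (+ n ℤ.<_) (ℤP.pos-* a i) (ℤ.+<+ (ℕP.<-≤-trans n<i (ℕP.m≤n*m i a {{ℕ.>-nonZero 1≤a}})))

    altSum-negative : ∀ B n m → n ℤ.< 0ℤ → altSum B n m ≡ 0ℤ
    altSum-negative B n m n<0 = sumℤ-zero B _ (λ i →
      trans (cong (sgn i *_) (summand-vanishes i n m (ℤP.<-≤-trans n<0 (subst (0ℤ ℤ.≤_) (ℤP.pos-* a i) (ℤ.+≤+ ℕ.z≤n)))))
            (ℤP.*-zeroʳ (sgn i)))

    closedForm-step : ∀ n m → 1 ℕ.≤ a → c ℕ.≤ a → n ℕ.≤ suc m →
      closedForm n (suc m) ≡ closedForm n m + left closedForm n (suc m) - altSum n (+ n - + a) (+ suc m - + c)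
    closedForm-step n m 1≤a c≤a n≤m+1 =
      trans (altSum-recurrence n (+ n) (+ suc m) (λ i → support i n (suc m) c≤a n≤m+1 (ℕ.s≤s ℕ.z≤n)))
        (trans (cong (λ t → t + closedForm n m - T) (left-term n))
               (swap (left closedForm n (suc m)) (closedForm n m) T))
      where
      T = altSum n (+ n - + a) (+ suc m - + c)
      swap : ∀ p q t → p + q - t ≡ q + p - t
      swap = solve-∀
      left-term : ∀ n → altSum (suc n) (+ n - 1ℤ) (+ suc m) ≡ left closedForm n (suc m)
      left-term zero = altSum-negative 1 -[1+ 0 ] (+ suc m) ℤ.-<+
      left-term (suc n) = altSum-truncate n (+ suc m) (suc (suc n)) 1≤a (ℕ.s≤s (ℕP.n≤1+n n))

    pattern-term : ∀ n m → 1 ℕ.≤ a → c ℕ.≤ a → a ℕ.≤ n → n ℕ.≤ m →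
      altSum n (+ n - + a) (+ m - + c) ≡ closedForm (n ℕ.∸ a) (m ℕ.∸ c)
    pattern-term n m 1≤a c≤a a≤n n≤m rewrite pos-∸ n a a≤n | pos-∸ m c (ℕP.≤-trans c≤a (ℕP.≤-trans a≤n n≤m)) =
      altSum-truncate (n ℕ.∸ a) (+ (m ℕ.∸ c)) n 1≤a
        (subst (ℕ._≤ n) (ℕP.+-comm (n ℕ.∸ a) 1) (ℕP.≤-trans (ℕP.+-monoʳ-≤ (n ℕ.∸ a) 1≤a) (ℕP.≤-reflexive (ℕP.m∸n+n≡m a≤n))))

    no-pattern-term : ∀ n m → n ℕ.< a → altSum n (+ n - + a) (+ m - + c) ≡ 0ℤ
    no-pattern-term n m n<a = altSum-negative n (+ n - + a) (+ m - + c)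
      (subst (+ n - + a ℤ.<_) (ℤP.+-inverseʳ (+ a)) (ℤP.+-monoˡ-< (- + a) (ℤ.+<+ n<a)))

    closedForm-origin : closedForm 0 0 ≡ 1ℤ
    closedForm-origin = cong (λ z → 1ℤ * z + 0ℤ) summand₀-origin
      where
      summand₀-origin : summand 0 0ℤ 0ℤ ≡ 1ℤ
      summand₀-origin rewrite ℤP.*-zeroʳ (+ a - 1ℤ) | ℤP.*-zeroʳ (+ c) | ℤP.*-zeroʳ e = refl

    -- Just below the diagonal every summand vanishes: the factor y - x + 1 - e·i of
    -- the kernel's closed form is 0 there, so the kernel is 0 unless y = -1, and
    -- that case is excluded by c < a or is the corner point of the kernel (c = a).
    closed-form-zero : ∀ i k → (Y i (+ k) + 1ℤ) * summand i (+ suc k) (+ k) ≡ 0ℤ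
    closed-form-zero i k = trans (kernel-closed-form e (+ i) (X i (+ suc k)) (Y i (+ k)))
      (cong (λ z → z * binom (X i (+ suc k)) (+ i) * binom (X i (+ suc k) + Y i (+ k)) (X i (+ suc k)))
            (vanishing-factor (+ a) (+ c) (+ i) (+ k)))
      where
      vanishing-factor : ∀ a c i k → (k - c * i) - ((1ℤ + k) - (a - 1ℤ) * i) + 1ℤ - (a - c - 1ℤ) * i ≡ 0ℤ
      vanishing-factor = solve-∀

    edge : ∀ i k → Y i (+ k) + 1ℤ ≡ 0ℤ → c ℕ.* i ≡ suc k
    edge i k y+1≡0 = trans (cong ℤ.∣_∣ (trans (ℤP.pos-* c i) (sym (ℤP.i-j≡0⇒i≡j (+ k + 1ℤ) (+ c * + i) (trans (rearrange (+ k) (+ c) (+ i)) y+1≡0)))))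
                           (ℕP.+-comm k 1)
      where
      rearrange : ∀ k c i → k + 1ℤ - c * i ≡ (k - c * i) + 1ℤ
      rearrange = solve-∀

    on-the-edge : ∀ i k → c ℕ.< a ⊎ c ≡ a → c ℕ.* i ≡ suc k → summand i (+ suc k) (+ k) ≡ 0ℤ
    on-the-edge zero k _ ci≡k+1 = ⊥-elim (ℕP.0≢1+n (trans (sym (ℕP.*-zeroʳ c)) ci≡k+1))
    on-the-edge (suc j) k (inj₁ c<a) ci≡k+1 = summand-vanishes (suc j) (+ suc k) (+ k)
      (subst (ℤ._< + a * + suc j) (cong +_ ci≡k+1)
        (subst (+ (c ℕ.* suc j) ℤ.<_) (ℤP.pos-* a (suc j)) (ℤ.+<+ (ℕP.*-monoˡ-< (suc j) c<a))))
    on-the-edge (suc j) k (inj₂ c≡a) ci≡k+1 =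
      trans (cong₂ (λ e′ x → kernel e′ (+ suc j) x (Y (suc j) (+ k))) e≡-1 x≡j+1)
            (trans (cong (kernel -[1+ 0 ] (+ suc j) (+ suc j)) y≡-1) (kernel-corner j))
      where
      ci : + c * + suc j ≡ + suc k
      ci = trans (sym (ℤP.pos-* c (suc j))) (cong +_ ci≡k+1)
      e≡-1 : e ≡ -[1+ 0 ]
      e≡-1 = trans (cong (λ t → + t - + c - 1ℤ) (sym c≡a)) (lemma (+ c))
        where
        lemma : ∀ c → c - c - 1ℤ ≡ - 1ℤ
        lemma = solve-∀
      x≡j+1 : X (suc j) (+ suc k) ≡ + suc j
      x≡j+1 = trans (cong₂ (λ z t → z - (+ t - 1ℤ) * + suc j) (sym ci) (sym c≡a)) (lemma (+ c) (+ suc j))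
        where
        lemma : ∀ c j → c * j - (c - 1ℤ) * j ≡ j
        lemma = solve-∀
      y≡-1 : Y (suc j) (+ k) ≡ -[1+ 0 ]
      y≡-1 = trans (cong (λ z → + k - z) ci) (lemma (+ k))
        where
        lemma : ∀ k → k - (1ℤ + k) ≡ - 1ℤ
        lemma = solve-∀

    summand-below-diagonal : ∀ i k → c ℕ.≤ a → summand i (+ suc k) (+ k) ≡ 0ℤ
    summand-below-diagonal i k c≤a = from-factors (ℤP.i*j≡0⇒i≡0∨j≡0 (Y i (+ k) + 1ℤ) (closed-form-zero i k))
      where
      from-factors : Y i (+ k) + 1ℤ ≡ 0ℤ ⊎ summand i (+ suc k) (+ k) ≡ 0ℤ → summand i (+ suc k) (+ k) ≡ 0ℤ
      from-factors (inj₂ summand≡0) = summand≡0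
      from-factors (inj₁ y+1≡0) = on-the-edge i k (ℕP.m≤n⇒m<n∨m≡n c≤a) (edge i k y+1≡0)

    closedForm-below-diagonal : c ℕ.≤ a → ∀ k → closedForm (suc k) k ≡ 0ℤ
    closedForm-below-diagonal c≤a k = sumℤ-zero (suc (suc k)) _
      (λ i → trans (cong (sgn i *_) (summand-below-diagonal i k c≤a)) (ℤP.*-zeroʳ (sgn i)))

    closedForm-recurrence : 1 ℕ.≤ a → c ℕ.≤ a → BallotRecurrence a c closedForm
    closedForm-recurrence 1≤a c≤a = record
      { origin = closedForm-origin
      ; below-diagonal = closedForm-below-diagonal c≤a
      ; step-short = λ n m n≤m+1 n<a →
          trans (closedForm-step n m 1≤a c≤a n≤m+1) (minus-zero _ _ (no-pattern-term n (suc m) n<a))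
      ; step-long = λ n m n≤m+1 a≤n →
          trans (closedForm-step n m 1≤a c≤a n≤m+1)
                (cong (λ t → closedForm n m + left closedForm n (suc m) - t) (pattern-term n (suc m) 1≤a c≤a a≤n n≤m+1))
      }
      where
      minus-zero : ∀ x t → t ≡ 0ℤ → x - t ≡ x
      minus-zero x t refl = ℤP.+-identityʳ x

module Formula where

  open Binomial
  open Kernel
  open ClosedForm
  open import Defs using (sgn; sumTo; term; formula; floorDivPred)
  open import Data.Nat as ℕ using (ℕ; zero; suc)
  import Data.Nat.Properties as ℕP
  open import Data.Nat.DivMod using (_/_; m*n/n≡m; /-monoˡ-≤; m/n≤m)
  open import Data.Nat.Combinatorics using (_C_)
  open import Data.Integer as ℤ using (ℤ; +_; 1ℤ)
  import Data.Integer.Properties as ℤP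
  open import Data.Integer.Tactic.RingSolver using (solve-∀)
  open import Data.Rational as ℚ using (ℚ; 0ℚ)
  import Data.Rational.Properties as ℚP
  open import Data.Rational.Unnormalised using (mkℚᵘ; *≡*)
  import Data.Rational.Unnormalised.Properties as ℚᵘP
  open import Data.List using (foldr; applyUpTo)
  open import Data.Bool using (true; false; T)
  open import Data.Unit using (tt)
  open import Data.Empty using (⊥-elim)
  open import Function using (_∘_; id)
  open import Relation.Nullary using (¬_; yes; no)
  open import Relation.Binary.PropositionalEquality

  clear-denominator : ∀ (h p z : ℤ) (q : ℕ) → + suc q ℤ.* z ≡ h ℤ.* p → (h ℚ./ 1) ℚ.* (p ℚ./ suc q) ≡ z ℚ./ 1
  clear-denominator h p z q eq = ℚP.toℚᵘ-injective
    (ℚᵘP.≃-trans (ℚP.toℚᵘ-homo-* (h ℚ./ 1) (p ℚ./ suc q))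
    (ℚᵘP.≃-trans (ℚᵘP.*-cong (ℚP.toℚᵘ-fromℚᵘ (mkℚᵘ h 0)) (ℚP.toℚᵘ-fromℚᵘ (mkℚᵘ p q)))
    (ℚᵘP.≃-trans (*≡* cross) (ℚᵘP.≃-sym (ℚP.toℚᵘ-fromℚᵘ (mkℚᵘ z 0))))))
    where
    cross : (h ℤ.* p) ℤ.* + 1 ≡ z ℤ.* + suc (q ℕ.+ 0)
    cross rewrite ℕP.+-identityʳ q = trans (ℤP.*-identityʳ (h ℤ.* p)) (trans (sym eq) (ℤP.*-comm (+ suc q) z))

  /1-homo-+ : ∀ p q → (p ℚ./ 1) ℚ.+ (q ℚ./ 1) ≡ (p ℤ.+ q) ℚ./ 1
  /1-homo-+ p q = ℚP.toℚᵘ-injective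
    (ℚᵘP.≃-trans (ℚP.toℚᵘ-homo-+ (p ℚ./ 1) (q ℚ./ 1))
    (ℚᵘP.≃-trans (ℚᵘP.+-cong (ℚP.toℚᵘ-fromℚᵘ (mkℚᵘ p 0)) (ℚP.toℚᵘ-fromℚᵘ (mkℚᵘ q 0)))
    (ℚᵘP.≃-trans (*≡* (cross p q)) (ℚᵘP.≃-sym (ℚP.toℚᵘ-fromℚᵘ (mkℚᵘ (p ℤ.+ q) 0))))))
    where
    cross : ∀ p q → (p ℤ.* + 1 ℤ.+ q ℤ.* + 1) ℤ.* + 1 ≡ (p ℤ.+ q) ℤ.* + 1
    cross = solve-∀

  -- A scaled sum of rationals, each of whose scaled terms is an integer, is the
  -- integer sum; stated for the folds over applyUpTo that sumTo unfolds to.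
  scaled-sum : ∀ B (g : ℕ → ℕ) (k : ℚ) (f : ℕ → ℚ) (z : ℕ → ℤ) → (∀ i → k ℚ.* f (g i) ≡ z i ℚ./ 1) →
    k ℚ.* foldr (λ i acc → f i ℚ.+ acc) 0ℚ (applyUpTo g B) ≡ sumℤ B z ℚ./ 1
  scaled-sum zero g k f z _ = ℚP.*-zeroʳ k
  scaled-sum (suc B) g k f z kf≡z = begin
      k ℚ.* (f (g 0) ℚ.+ rest)
        ≡⟨ ℚP.*-distribˡ-+ k (f (g 0)) rest ⟩
      k ℚ.* f (g 0) ℚ.+ k ℚ.* rest
        ≡⟨ cong₂ ℚ._+_ (kf≡z 0) (scaled-sum B (g ∘ suc) k f (z ∘ suc) (kf≡z ∘ suc)) ⟩
      z 0 ℚ./ 1 ℚ.+ sumℤ B (z ∘ suc) ℚ./ 1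
        ≡⟨ /1-homo-+ (z 0) (sumℤ B (z ∘ suc)) ⟩
      sumℤ (suc B) z ℚ./ 1
        ∎
    where
    open ≡-Reasoning
    rest = foldr (λ i acc → f i ℚ.+ acc) 0ℚ (applyUpTo (g ∘ suc) B)

  floorDivPred-bound : ∀ a n i → 2 ℕ.≤ a → a ℕ.* i ℕ.≤ n → i ℕ.≤ floorDivPred n a
  floorDivPred-bound zero n i () ai≤n
  floorDivPred-bound (suc zero) n i (ℕ.s≤s ()) ai≤n
  floorDivPred-bound (suc (suc k)) n i _ ai≤n = subst (ℕ._≤ n / suc k) (m*n/n≡m i (suc k))
    (/-monoˡ-≤ (suc k) (ℕP.≤-trans (ℕP.≤-reflexive (ℕP.*-comm i (suc k))) (ℕP.≤-trans (ℕP.m≤n+m (suc k ℕ.* i) i) ai≤n)))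

  floorDivPred-≤ : ∀ a n → floorDivPred n a ℕ.≤ n
  floorDivPred-≤ zero n = ℕ.z≤n
  floorDivPred-≤ (suc zero) n = ℕ.z≤n
  floorDivPred-≤ (suc (suc k)) n = m/n≤m n (suc k)

  module Agreement (a c : ℕ) where
    open AlternatingSum a c

    summand-closed-form : ∀ n m i → 1 ℕ.≤ a → c ℕ.≤ a → n ℕ.≤ m → a ℕ.* i ℕ.≤ n →
      let x = n ℕ.∸ (a ℕ.∸ 1) ℕ.* i
          N = (m ℕ.+ n) ℕ.∸ (a ℕ.+ c ℕ.∸ 1) ℕ.* i
      in + suc (m ℕ.∸ c ℕ.* i) ℤ.* summand i (+ n) (+ m) ≡ + (m ℕ.∸ n ℕ.+ 1) ℤ.* + (x C i) ℤ.* + (N C x)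
    summand-closed-form n m i 1≤a c≤a n≤m ai≤n = closed
      where
      x = n ℕ.∸ (a ℕ.∸ 1) ℕ.* i
      y = m ℕ.∸ c ℕ.* i
      N = (m ℕ.+ n) ℕ.∸ (a ℕ.+ c ℕ.∸ 1) ℕ.* i
      h = + (m ℕ.∸ n ℕ.+ 1)
      [a-1]i≤n : (a ℕ.∸ 1) ℕ.* i ℕ.≤ n
      [a-1]i≤n = ℕP.≤-trans (ℕP.*-monoˡ-≤ i (ℕP.m∸n≤m a 1)) ai≤n
      ci≤m : c ℕ.* i ℕ.≤ m
      ci≤m = ℕP.≤-trans (ℕP.*-monoˡ-≤ i c≤a) (ℕP.≤-trans ai≤n n≤m)
      [a+c-1]i≤m+n : (a ℕ.+ c ℕ.∸ 1) ℕ.* i ℕ.≤ m ℕ.+ n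
      [a+c-1]i≤m+n = ℕP.≤-trans (ℕP.*-monoˡ-≤ i (ℕP.m∸n≤m (a ℕ.+ c) 1))
        (ℕP.≤-trans (ℕP.≤-reflexive (ℕP.*-distribʳ-+ i a c)) (ℕP.≤-trans (ℕP.+-mono-≤ ai≤n ci≤m) (ℕP.≤-reflexive (ℕP.+-comm n m))))
      X≡x : X i (+ n) ≡ + x
      X≡x = trans (cong (λ z → + n ℤ.- z ℤ.* + i) (pos-∸ a 1 1≤a))
            (trans (cong (λ z → + n ℤ.- z) (sym (ℤP.pos-* (a ℕ.∸ 1) i))) (pos-∸ n _ [a-1]i≤n))
      Y≡y : Y i (+ m) ≡ + y
      Y≡y = trans (cong (λ z → + m ℤ.- z) (sym (ℤP.pos-* c i))) (pos-∸ m _ ci≤m)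
      X+Y≡N : X i (+ n) ℤ.+ Y i (+ m) ≡ + N
      X+Y≡N = trans (sum-XY (+ a) (+ c) (+ i) (+ n) (+ m))
              (trans (cong (λ z → (+ m ℤ.+ + n) ℤ.- z ℤ.* + i) (pos-∸ (a ℕ.+ c) 1 (ℕP.≤-trans 1≤a (ℕP.m≤m+n a c))))
              (trans (cong (λ z → (+ m ℤ.+ + n) ℤ.- z) (sym (ℤP.pos-* (a ℕ.+ c ℕ.∸ 1) i))) (pos-∸ (m ℕ.+ n) _ [a+c-1]i≤m+n)))
        where
        sum-XY : ∀ a c i n m → (n ℤ.- (a ℤ.- 1ℤ) ℤ.* i) ℤ.+ (m ℤ.- c ℤ.* i) ≡ (m ℤ.+ n) ℤ.- ((a ℤ.+ c) ℤ.- 1ℤ) ℤ.* i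
        sum-XY = solve-∀
      factor≡h : Y i (+ m) ℤ.- X i (+ n) ℤ.+ 1ℤ ℤ.- e ℤ.* + i ≡ h
      factor≡h = trans (factor (+ a) (+ c) (+ i) (+ n) (+ m)) (cong (ℤ._+ 1ℤ) (pos-∸ m n n≤m))
        where
        factor : ∀ a c i n m → (m ℤ.- c ℤ.* i) ℤ.- (n ℤ.- (a ℤ.- 1ℤ) ℤ.* i) ℤ.+ 1ℤ ℤ.- (a ℤ.- c ℤ.- 1ℤ) ℤ.* i ≡ (m ℤ.- n) ℤ.+ 1ℤ
        factor = solve-∀
      closed : + suc y ℤ.* summand i (+ n) (+ m) ≡ h ℤ.* + (x C i) ℤ.* + (N C x)
      closed = begin
          + suc y ℤ.* summand i (+ n) (+ m)
            ≡⟨ cong (ℤ._* summand i (+ n) (+ m)) (cong +_ (ℕP.+-comm 1 y)) ⟩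
          (+ y ℤ.+ 1ℤ) ℤ.* summand i (+ n) (+ m)
            ≡⟨ cong (λ z → (z ℤ.+ 1ℤ) ℤ.* summand i (+ n) (+ m)) (sym Y≡y) ⟩
          (Y i (+ m) ℤ.+ 1ℤ) ℤ.* summand i (+ n) (+ m)
            ≡⟨ kernel-closed-form e (+ i) (X i (+ n)) (Y i (+ m)) ⟩
          (Y i (+ m) ℤ.- X i (+ n) ℤ.+ 1ℤ ℤ.- e ℤ.* + i) ℤ.* binom (X i (+ n)) (+ i) ℤ.* binom (X i (+ n) ℤ.+ Y i (+ m)) (X i (+ n))
            ≡⟨ cong₂ (λ u v → u ℤ.* binom v (+ i) ℤ.* binom (X i (+ n) ℤ.+ Y i (+ m)) v) factor≡h X≡x ⟩
          h ℤ.* + (x C i) ℤ.* binom (X i (+ n) ℤ.+ Y i (+ m)) (+ x)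
            ≡⟨ cong (λ v → h ℤ.* + (x C i) ℤ.* binom v (+ x)) X+Y≡N ⟩
          h ℤ.* + (x C i) ℤ.* + (N C x)
            ∎
        where open ≡-Reasoning

    -- Each rational summand, scaled by m - n + 1, is the signed kernel summand;
    -- for a·i ≤ n by the closed form above, otherwise both sides vanish.
    term-scaled : ∀ n m i → 1 ℕ.≤ a → c ℕ.≤ a → n ℕ.≤ m →
      (+ (m ℕ.∸ n ℕ.+ 1) ℚ./ 1) ℚ.* term a c n m i ≡ (sgn i ℤ.* summand i (+ n) (+ m)) ℚ./ 1
    term-scaled n m i 1≤a c≤a n≤m with a ℕ.* i ℕ.≤ᵇ n in ai≤ᵇn
    ... | false = trans (ℚP.*-zeroʳ (+ (m ℕ.∸ n ℕ.+ 1) ℚ./ 1))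
        (sym (cong (ℚ._/ 1) (trans (cong (sgn i ℤ.*_) (summand-vanishes i (+ n) (+ m) n<ai)) (ℤP.*-zeroʳ (sgn i)))))
      where
      ai≰n : ¬ (a ℕ.* i ℕ.≤ n)
      ai≰n ai≤n = subst T ai≤ᵇn (ℕP.≤⇒≤ᵇ ai≤n)
      n<ai : + n ℤ.< + a ℤ.* + i
      n<ai = subst (+ n ℤ.<_) (ℤP.pos-* a i) (ℤ.+<+ (ℕP.≰⇒> ai≰n))
    ... | true = clear-denominator h (sgn i ℤ.* + ((x C i) ℕ.* (N C x))) (sgn i ℤ.* summand i (+ n) (+ m)) y scaled
      where
      x = n ℕ.∸ (a ℕ.∸ 1) ℕ.* i
      y = m ℕ.∸ c ℕ.* i
      N = (m ℕ.+ n) ℕ.∸ (a ℕ.+ c ℕ.∸ 1) ℕ.* i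
      h = + (m ℕ.∸ n ℕ.+ 1)
      closed : + suc y ℤ.* summand i (+ n) (+ m) ≡ h ℤ.* + (x C i) ℤ.* + (N C x)
      closed = summand-closed-form n m i 1≤a c≤a n≤m (ℕP.≤ᵇ⇒≤ _ _ (subst T (sym ai≤ᵇn) tt))
      scaled : + suc y ℤ.* (sgn i ℤ.* summand i (+ n) (+ m)) ≡ h ℤ.* (sgn i ℤ.* + ((x C i) ℕ.* (N C x)))
      scaled = begin
          + suc y ℤ.* (sgn i ℤ.* summand i (+ n) (+ m))  ≡⟨ swap (+ suc y) (sgn i) (summand i (+ n) (+ m)) ⟩
          sgn i ℤ.* (+ suc y ℤ.* summand i (+ n) (+ m))  ≡⟨ cong (sgn i ℤ.*_) closed ⟩
          sgn i ℤ.* (h ℤ.* + (x C i) ℤ.* + (N C x))      ≡⟨ swap′ h (sgn i) (+ (x C i)) (+ (N C x)) ⟩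
          h ℤ.* (sgn i ℤ.* (+ (x C i) ℤ.* + (N C x)))    ≡⟨ cong (λ z → h ℤ.* (sgn i ℤ.* z)) (sym (ℤP.pos-* (x C i) (N C x))) ⟩
          h ℤ.* (sgn i ℤ.* + ((x C i) ℕ.* (N C x)))        ∎
        where
        open ≡-Reasoning
        swap : ∀ q s g → q ℤ.* (s ℤ.* g) ≡ s ℤ.* (q ℤ.* g)
        swap = solve-∀
        swap′ : ∀ h s u v → s ℤ.* (h ℤ.* u ℤ.* v) ≡ h ℤ.* (s ℤ.* (u ℤ.* v))
        swap′ = solve-∀

    formula≡closedForm : ∀ n m → 2 ℕ.≤ a → c ℕ.≤ a → n ℕ.≤ m → formula a c n m ≡ closedForm n m ℚ./ 1
    formula≡closedForm n m 2≤a c≤a n≤m =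
      trans (scaled-sum (suc D) id (+ (m ℕ.∸ n ℕ.+ 1) ℚ./ 1) (term a c n m) (λ i → sgn i ℤ.* summand i (+ n) (+ m))
                        (λ i → term-scaled n m i 1≤a c≤a n≤m))
            (cong (ℚ._/ 1) (sym (altSum-stable (suc D) (suc n) (+ n) (+ m) (ℕ.s≤s (floorDivPred-≤ a n)) beyond)))
      where
      D = floorDivPred n a
      1≤a : 1 ℕ.≤ a
      1≤a = ℕP.≤-trans (ℕ.s≤s ℕ.z≤n) 2≤a
      beyond : ∀ i → suc D ℕ.≤ i → + n ℤ.< + a ℤ.* + i
      beyond i D<i with a ℕ.* i ℕ.≤? n
      ... | yes ai≤n = ⊥-elim (ℕP.<-irrefl refl (ℕP.<-≤-trans D<i (floorDivPred-bound a n i 2≤a ai≤n)))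
      ... | no ai≰n = subst (+ n ℤ.<_) (ℤP.pos-* a i) (ℤ.+<+ (ℕP.≰⇒> ai≰n))

module Words where

  open import Defs
  open import Data.Nat as ℕ using (ℕ; zero; suc; _+_; _∸_; _≤_; _<_; z≤n; s≤s)
  import Data.Nat.Properties as ℕP
  open import Data.Nat.Tactic.RingSolver as ℕSolver using ()
  open import Data.List using (List; []; _∷_; _++_; map; length; filterᵇ; take; drop; inits)
  import Data.List.Properties as LP
  open import Data.Bool using (Bool; true; false; _∧_; _∨_; not; T)
  open import Data.Bool.Properties using (T-∧; T-∨)
  open import Data.Bool.ListAction using (all)
  open import Data.Unit using (tt; ⊤)
  open import Data.Empty using (⊥; ⊥-elim)
  open import Data.Product using (∃; _×_; _,_; proj₁)
  open import Data.Sum using (_⊎_; inj₁; inj₂)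
  open import Function using (_∘_)
  open import Function.Bundles using (Equivalence)
  open import Relation.Binary.PropositionalEquality
  open import Relation.Nullary using (¬_)
  open import Relation.Nullary.Decidable using (⌊_⌋; toWitness; fromWitness)
  import Data.Integer as ℤ
  import Data.Integer.Properties as ℤP
  open import Data.Integer.Tactic.RingSolver using (solve-∀)

  +-interchange : ∀ a b c d → a + b + (c + d) ≡ a + c + (b + d)
  +-interchange = ℕSolver.solve-∀

  sumOver : ∀ {A : Set} → List A → (A → ℕ) → ℕ
  sumOver [] f = 0
  sumOver (x ∷ xs) f = f x + sumOver xs f

  sumOver-cong : ∀ {A : Set} (xs : List A) {f g} → (∀ x → f x ≡ g x) → sumOver xs f ≡ sumOver xs g
  sumOver-cong [] eq = refl
  sumOver-cong (x ∷ xs) eq = cong₂ _+_ (eq x) (sumOver-cong xs eq)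

  sumOver-+ : ∀ {A : Set} (xs : List A) f g → sumOver xs (λ x → f x + g x) ≡ sumOver xs f + sumOver xs g
  sumOver-+ [] f g = refl
  sumOver-+ (x ∷ xs) f g rewrite sumOver-+ xs f g = +-interchange (f x) (g x) (sumOver xs f) (sumOver xs g)

  sumOver-++ : ∀ {A : Set} (xs ys : List A) f → sumOver (xs ++ ys) f ≡ sumOver xs f + sumOver ys f
  sumOver-++ [] ys f = refl
  sumOver-++ (x ∷ xs) ys f rewrite sumOver-++ xs ys f = sym (ℕP.+-assoc (f x) _ _)

  sumOver-map : ∀ {A B : Set} (g : A → B) (xs : List A) f → sumOver (map g xs) f ≡ sumOver xs (f ∘ g)
  sumOver-map g [] f = refl
  sumOver-map g (x ∷ xs) f = cong (f (g x) +_) (sumOver-map g xs f)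

  count : ∀ {A : Set} → List A → (A → Bool) → ℕ
  count xs P = length (filterᵇ P xs)

  count-++ : ∀ {A : Set} (xs ys : List A) P → count (xs ++ ys) P ≡ count xs P + count ys P
  count-++ [] ys P = refl
  count-++ (x ∷ xs) ys P with P x
  ... | true = cong suc (count-++ xs ys P)
  ... | false = count-++ xs ys P

  count-map : ∀ {A B : Set} (g : A → B) (xs : List A) P → count (map g xs) P ≡ count xs (P ∘ g)
  count-map g [] P = refl
  count-map g (x ∷ xs) P with P (g x)
  ... | true = cong suc (count-map g xs P)
  ... | false = count-map g xs P

  count-cong : ∀ {A : Set} (xs : List A) {P Q} → (∀ x → P x ≡ Q x) → count xs P ≡ count xs Q
  count-cong [] eq = refl
  count-cong (x ∷ xs) {P} {Q} eq with P x | Q x | eq x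
  ... | true | .true | refl = cong suc (count-cong xs eq)
  ... | false | .false | refl = count-cong xs eq

  count-none : ∀ {A : Set} (xs : List A) P → (∀ x → P x ≡ false) → count xs P ≡ 0
  count-none [] P h = refl
  count-none (x ∷ xs) P h with P x | h x
  ... | false | refl = count-none xs P h

  count-split : ∀ {A : Set} (xs : List A) (P Q : A → Bool) → count xs P ≡ count xs (λ x → P x ∧ not (Q x)) + count xs (λ x → P x ∧ Q x)
  count-split [] P Q = refl
  count-split (x ∷ xs) P Q with P x | Q x
  ... | false | _ = count-split xs P Q
  ... | true | true = trans (cong suc (count-split xs P Q)) (sym (ℕP.+-suc _ _))
  ... | true | false = cong suc (count-split xs P Q)

  count-as-sum : ∀ {A : Set} (xs : List A) P → count xs P ≡ sumOver xs (λ s → count (s ∷ []) P)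
  count-as-sum [] P = refl
  count-as-sum (x ∷ xs) P with P x
  ... | true = cong suc (count-as-sum xs P)
  ... | false = count-as-sum xs P

  countWords : ℕ → (List Step → Bool) → ℕ
  countWords k P = count (words k) P

  countWords-suc : ∀ j P → countWords (suc j) P ≡ countWords j (λ v → P (u ∷ v)) + countWords j (λ v → P (r ∷ v))
  countWords-suc j P = trans (count-++ (map (u ∷_) (words j)) _ P) (cong₂ _+_ (count-map (u ∷_) (words j) P) (count-map (r ∷_) (words j) P))

  countWords-++ : ∀ j L P → countWords (j + L) P ≡ sumOver (words L) (λ s → countWords j (λ v → P (v ++ s)))
  countWords-++ zero L P = trans (count-as-sum (words L) P) (sumOver-cong (words L) single)
    where
    single : ∀ s → count (s ∷ []) P ≡ countWords 0 (λ v → P (v ++ s))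
    single s with P s
    ... | true = refl
    ... | false = refl
  countWords-++ (suc j) L P =
    trans (countWords-suc (j + L) P)
    (trans (cong₂ _+_ (countWords-++ j L (λ v → P (u ∷ v))) (countWords-++ j L (λ v → P (r ∷ v))))
    (trans (sym (sumOver-+ (words L) _ _))
    (sumOver-cong (words L) (λ s → sym (countWords-suc j (λ v → P (v ++ s)))))))

  sumWords-suc : ∀ L f → sumOver (words (suc L)) f ≡ sumOver (words L) (f ∘ (u ∷_)) + sumOver (words L) (f ∘ (r ∷_))
  sumWords-suc L f = trans (sumOver-++ (map (u ∷_) (words L)) _ f)
    (cong₂ _+_ (sumOver-map (u ∷_) (words L) f) (sumOver-map (r ∷_) (words L) f))

  sumWords-zero : ∀ L f → (∀ s → length s ≡ L → f s ≡ 0) → sumOver (words L) f ≡ 0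
  sumWords-zero zero f f≡0 = cong (_+ 0) (f≡0 [] refl)
  sumWords-zero (suc L) f f≡0 = trans (sumWords-suc L f)
    (cong₂ _+_ (sumWords-zero L _ (λ s |s| → f≡0 (u ∷ s) (cong suc |s|)))
               (sumWords-zero L _ (λ s |s| → f≡0 (r ∷ s) (cong suc |s|))))

  sumWords-single : ∀ L q (f : List Step → ℕ) → length q ≡ L → (∀ s → length s ≡ L → ¬ s ≡ q → f s ≡ 0) →
    sumOver (words L) f ≡ f q
  sumWords-single zero [] f _ f≡0 = ℕP.+-identityʳ (f [])
  sumWords-single (suc L) (u ∷ q) f |q| f≡0 = trans (sumWords-suc L f)
    (trans (cong₂ _+_ (sumWords-single L q (f ∘ (u ∷_)) (ℕP.suc-injective |q|)
                         (λ s |s| s≢q → f≡0 (u ∷ s) (cong suc |s|) (s≢q ∘ LP.∷-injectiveʳ)))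
                      (sumWords-zero L _ (λ s |s| → f≡0 (r ∷ s) (cong suc |s|) (λ ()))))
           (ℕP.+-identityʳ _))
  sumWords-single (suc L) (r ∷ q) f |q| f≡0 = trans (sumWords-suc L f)
    (cong₂ _+_ (sumWords-zero L _ (λ s |s| → f≡0 (u ∷ s) (cong suc |s|) (λ ())))
               (sumWords-single L q (f ∘ (r ∷_)) (ℕP.suc-injective |q|)
                  (λ s |s| s≢q → f≡0 (r ∷ s) (cong suc |s|) (s≢q ∘ LP.∷-injectiveʳ))))

  T∧ : ∀ {x y} → T (x ∧ y) → T x × T y
  T∧ = Equivalence.to T-∧

  ∧T : ∀ {x y} → T x → T y → T (x ∧ y)
  ∧T tx ty = Equivalence.from T-∧ (tx , ty)

  T∨ : ∀ {x y} → T (x ∨ y) → T x ⊎ T y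
  T∨ = Equivalence.to T-∨

  ∨Tˡ : ∀ {x y} → T x → T (x ∨ y)
  ∨Tˡ tx = Equivalence.from T-∨ (inj₁ tx)

  ∨Tʳ : ∀ {x y} → T y → T (x ∨ y)
  ∨Tʳ ty = Equivalence.from T-∨ (inj₂ ty)

  Tnot : ∀ {x} → T (not x) → ¬ T x
  Tnot {false} _ ()

  notT : ∀ {x} → ¬ T x → T (not x)
  notT {true} ¬t = ¬t tt
  notT {false} _ = tt

  bool-ext : ∀ {x y : Bool} → (T x → T y) → (T y → T x) → x ≡ y
  bool-ext {true} {true} _ _ = refl
  bool-ext {true} {false} x⇒y _ = ⊥-elim (x⇒y tt)
  bool-ext {false} {true} _ y⇒x = ⊥-elim (y⇒x tt)
  bool-ext {false} {false} _ _ = refl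

  ≟-sound : ∀ {m n : ℕ} → T ⌊ m ℕ.≟ n ⌋ → m ≡ n
  ≟-sound {m} {n} = toWitness {a? = m ℕ.≟ n}

  ≟-complete : ∀ {m n : ℕ} → m ≡ n → T ⌊ m ℕ.≟ n ⌋
  ≟-complete {m} {n} = fromWitness {a? = m ℕ.≟ n}

  T-∧₄⁻ : ∀ {a b c d} → T (a ∧ b ∧ c ∧ d) → T a × T b × T c × T d
  T-∧₄⁻ {true} {true} {true} {true} _ = tt , tt , tt , tt

  T-∧₄⁺ : ∀ {a b c d} → T a → T b → T c → T d → T (a ∧ b ∧ c ∧ d)
  T-∧₄⁺ {true} {true} {true} {true} _ _ _ _ = tt

  ==ˢ-sound : ∀ {x y} → T (x ==ˢ y) → x ≡ y
  ==ˢ-sound {u} {u} _ = refl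
  ==ˢ-sound {r} {r} _ = refl

  ==ʷ-sound : ∀ {x y} → T (x ==ʷ y) → x ≡ y
  ==ʷ-sound {[]} {[]} _ = refl
  ==ʷ-sound {x ∷ xs} {y ∷ ys} t with T∧ {x ==ˢ y} t
  ... | a , b = cong₂ _∷_ (==ˢ-sound a) (==ʷ-sound b)

  ==ʷ-refl : ∀ x → T (x ==ʷ x)
  ==ʷ-refl [] = tt
  ==ʷ-refl (u ∷ xs) = ==ʷ-refl xs
  ==ʷ-refl (r ∷ xs) = ==ʷ-refl xs

  take-length-++ : ∀ {A : Set} (xs ys : List A) → take (length xs) (xs ++ ys) ≡ xs
  take-length-++ [] ys = refl
  take-length-++ (x ∷ xs) ys = cong (x ∷_) (take-length-++ xs ys)

  drop-length-++ : ∀ {A : Set} (xs ys : List A) → drop (length xs) (xs ++ ys) ≡ ys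
  drop-length-++ [] ys = refl
  drop-length-++ (x ∷ xs) ys = drop-length-++ xs ys

  ++-split : ∀ {A : Set} (xs ys zs ws : List A) → xs ++ ys ≡ zs ++ ws →
    (∃ λ m → zs ≡ xs ++ m × ys ≡ m ++ ws) ⊎ (∃ λ m → xs ≡ zs ++ m × ws ≡ m ++ ys)
  ++-split [] ys zs ws eq = inj₁ (zs , refl , eq)
  ++-split (x ∷ xs) ys [] ws eq = inj₂ (x ∷ xs , refl , sym eq)
  ++-split (x ∷ xs) ys (z ∷ zs) ws eq with LP.∷-injective eq
  ... | refl , rest with ++-split xs ys zs ws rest
  ... | inj₁ (m , zs≡ , ys≡) = inj₁ (m , cong (x ∷_) zs≡ , ys≡)
  ... | inj₂ (m , xs≡ , ws≡) = inj₂ (m , cong (x ∷_) xs≡ , ws≡)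

  snoc-split : ∀ {A : Set} (w : List A) x A' t → w ++ (x ∷ []) ≡ A' ++ t → t ≡ [] ⊎ ∃ λ t' → w ≡ A' ++ t'
  snoc-split w x [] t eq = inj₂ (w , refl)
  snoc-split [] x (y ∷ A') t eq = inj₁ (LP.++-conicalʳ A' t (sym (LP.∷-injectiveʳ eq)))
  snoc-split (z ∷ w) x (y ∷ A') t eq with LP.∷-injective eq
  ... | refl , rest with snoc-split w x A' t rest
  ... | inj₁ t≡[] = inj₁ t≡[]
  ... | inj₂ (t' , w≡A'++t') = inj₂ (t' , cong (z ∷_) w≡A'++t')

  Factor : List Step → List Step → Set
  Factor p W = ∃ λ v → ∃ λ t → W ≡ v ++ p ++ t

  Suffix : List Step → List Step → Set
  Suffix p W = ∃ λ v → W ≡ v ++ p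

  startsWith : List Step → List Step → Bool
  startsWith p s = take (length p) s ==ʷ p

  startsWith-sound : ∀ p s → T (startsWith p s) → ∃ λ t → s ≡ p ++ t
  startsWith-sound p s h = drop (length p) s , trans (sym (LP.take++drop≡id (length p) s)) (cong (_++ drop (length p) s) (==ʷ-sound h))

  startsWith-complete : ∀ p t → T (startsWith p (p ++ t))
  startsWith-complete p t = subst (λ z → T (z ==ʷ p)) (sym (take-length-++ p t)) (==ʷ-refl p)

  containsFactor-sound : ∀ p W → T (containsFactor p W) → Factor p W
  containsFactor-sound p [] h with T∨ {startsWith p []} h
  ... | inj₁ h1 with startsWith-sound p [] h1
  ... | t , e = [] , t , e
  containsFactor-sound p (x ∷ w) h with T∨ {startsWith p (x ∷ w)} h
  ... | inj₁ h1 with startsWith-sound p (x ∷ w) h1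
  ... | t , e = [] , t , e
  containsFactor-sound p (x ∷ w) h | inj₂ h2 with containsFactor-sound p w h2
  ... | v , t , e = x ∷ v , t , cong (x ∷_) e

  containsFactor-at : ∀ p v t → T (containsFactor p (v ++ p ++ t))
  containsFactor-at p [] t = ∨Tˡ {startsWith p (p ++ t)} (startsWith-complete p t)
  containsFactor-at p (y ∷ v) t = ∨Tʳ {startsWith p (y ∷ v ++ p ++ t)} (containsFactor-at p v t)

  containsFactor-complete : ∀ p W → Factor p W → T (containsFactor p W)
  containsFactor-complete p W (v , t , refl) = containsFactor-at p v t

  endsWith : List Step → List Step → Bool
  endsWith p W = drop (length W ∸ length p) W ==ʷ p

  endsWith-sound : ∀ p W → T (endsWith p W) → Suffix p W
  endsWith-sound p W h = take k W , trans (sym (LP.take++drop≡id k W)) (cong (take k W ++_) (==ʷ-sound h))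
    where k = length W ∸ length p

  endsWith-at : ∀ p v → T (endsWith p (v ++ p))
  endsWith-at p v = subst (λ z → T (drop z (v ++ p) ==ʷ p)) (sym eqk) (subst (λ z → T (z ==ʷ p)) (sym (drop-length-++ v p)) (==ʷ-refl p))
    where
    eqk : length (v ++ p) ∸ length p ≡ length v
    eqk = trans (cong (_∸ length p) (LP.length-++ v)) (ℕP.m+n∸n≡m (length v) (length p))

  endsWith-complete : ∀ p W → Suffix p W → T (endsWith p W)
  endsWith-complete p W (v , refl) = endsWith-at p v

  factor-of-snoc : ∀ p w x → Factor p (w ++ x ∷ []) → Factor p w ⊎ Suffix p (w ++ x ∷ [])
  factor-of-snoc p w x (v , t , e) with snoc-split w x (v ++ p) t (trans e (sym (LP.++-assoc v p t)))
  ... | inj₁ refl = inj₂ (v , trans e (cong (v ++_) (LP.++-identityʳ p)))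
  ... | inj₂ (t' , e') = inj₁ (v , t' , trans e' (LP.++-assoc v p t'))

  factor-snoc : ∀ p w x → Factor p w → Factor p (w ++ x ∷ [])
  factor-snoc p w x (v , t , refl) = v , t ++ x ∷ [] , trans (LP.++-assoc v (p ++ t) (x ∷ [])) (cong (v ++_) (LP.++-assoc p t (x ∷ [])))

  suffix⇒factor : ∀ p W → Suffix p W → Factor p W
  suffix⇒factor p W (v , e) = v , [] , trans e (cong (v ++_) (sym (LP.++-identityʳ p)))

  dropLast : ∀ {A : Set} → List A → List A
  dropLast [] = []
  dropLast (x ∷ []) = []
  dropLast (x ∷ y ∷ w) = x ∷ dropLast (y ∷ w)

  dropLast-snoc : ∀ {A : Set} (w : List A) x → dropLast (w ++ x ∷ []) ≡ w
  dropLast-snoc [] x = refl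
  dropLast-snoc (y ∷ []) x = refl
  dropLast-snoc (y ∷ z ∷ w) x = cong (y ∷_) (dropLast-snoc (z ∷ w) x)

  no-longer-factor : ∀ (ip p t m : List Step) → length p ≡ suc (length ip) → ip ≡ m ++ p ++ t → ⊥
  no-longer-factor ip p t m lp e = ℕP.<-irrefl refl (ℕP.<-≤-trans (subst (length ip <_) (sym lp) (ℕP.n<1+n _)) le)
    where
    le : length p ≤ length ip
    le = subst (length p ≤_) (sym (cong length e))
           (ℕP.≤-trans (ℕP.m≤m+n (length p) (length t))
             (ℕP.≤-trans (ℕP.≤-reflexive (sym (LP.length-++ p))) (ℕP.≤-trans (ℕP.m≤n+m _ (length m)) (ℕP.≤-reflexive (sym (LP.length-++ m))))))

  length-init : ∀ {p ip : List Step} {z} → p ≡ ip ++ z ∷ [] → length p ≡ suc (length ip)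
  length-init {ip = ip} refl = trans (LP.length-++ ip) (ℕP.+-comm (length ip) 1)

  no-border : ∀ p → BifixFree p → ∀ q b s → ¬ q ≡ [] → ¬ b ≡ [] → p ≡ q ++ b → p ≡ b ++ s → ⊥
  no-border p bifix-free [] b s q≢[] _ _ _ = q≢[] refl
  no-border p bifix-free q [] s _ b≢[] _ _ = b≢[] refl
  no-border p bifix-free (y ∷ q) (x ∷ b) s _ _ p≡q++b p≡b++s =
    subst T (trans (sym (cong₂ _==ʷ_ prefix suffix)) (bifix-free (length (x ∷ b)) (s≤s z≤n) |b|<|p|)) (==ʷ-refl (x ∷ b))
    where
    |p| : length p ≡ length (y ∷ q) + length (x ∷ b)
    |p| = trans (cong length p≡q++b) (LP.length-++ (y ∷ q))
    |b|<|p| : length (x ∷ b) < length p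
    |b|<|p| = subst (length (x ∷ b) <_) (sym |p|) (s≤s (ℕP.m≤n+m (length (x ∷ b)) (length q)))
    prefix : take (length (x ∷ b)) p ≡ x ∷ b
    prefix = trans (cong (take (length (x ∷ b))) p≡b++s) (take-length-++ (x ∷ b) s)
    suffix : drop (length p ∸ length (x ∷ b)) p ≡ x ∷ b
    suffix = trans (cong₂ drop (trans (cong (_∸ length (x ∷ b)) |p|) (ℕP.m+n∸n≡m (length (y ∷ q)) (length (x ∷ b)))) p≡q++b)
                   (drop-length-++ (y ∷ q) (x ∷ b))

  -- The key property of bifix-free patterns p = ip ++ [z]: appending ip to a word
  -- that avoids p creates no occurrence of p, since such an occurrence would
  -- straddle the junction and make a proper prefix of p equal to a suffix of p.
  bifix-extension : ∀ p ip z → BifixFree p → p ≡ ip ++ z ∷ [] → ∀ v → ¬ Factor p v → ¬ Factor p (v ++ ip)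
  bifix-extension p ip z bifix-free p≡ip∷z v v-avoids (A , t , v++ip≡A++p++t) with ++-split v ip A (p ++ t) v++ip≡A++p++t
  ... | inj₁ (m , _ , ip≡m++p++t) = no-longer-factor ip p t m (length-init p≡ip∷z) ip≡m++p++t
  ... | inj₂ (m , v≡A++m , p++t≡m++ip) with ++-split p t m ip p++t≡m++ip
  ... | inj₁ (m′ , m≡p++m′ , _) = v-avoids (A , m′ , trans v≡A++m (cong (A ++_) m≡p++m′))
  ... | inj₂ (m′ , p≡m++m′ , ip≡m′++t) = straddle m m′ v≡A++m p≡m++m′ ip≡m′++t
    where
    -- the occurrence A ++ p ++ t ends inside ip: p = m ++ m′ with m a suffix of v
    straddle : ∀ m m′ → v ≡ A ++ m → p ≡ m ++ m′ → ip ≡ m′ ++ t → ⊥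
    straddle m [] v≡A++m p≡m++[] _ =
      v-avoids (A , [] , trans v≡A++m (cong (A ++_) (trans (sym (LP.++-identityʳ m)) (trans (sym p≡m++[]) (sym (LP.++-identityʳ p))))))
    straddle [] (y ∷ m₂) _ p≡m′ ip≡m′++t =
      no-longer-factor ip p t [] (length-init p≡ip∷z) (trans ip≡m′++t (cong (_++ t) (sym p≡m′)))
    straddle (y ∷ m₁) (y′ ∷ m₂) _ p≡m++m′ ip≡m′++t =
      no-border p bifix-free (y ∷ m₁) (y′ ∷ m₂) (t ++ z ∷ []) (λ ()) (λ ()) p≡m++m′
        (trans p≡ip∷z (trans (cong (_++ z ∷ []) ip≡m′++t) (LP.++-assoc (y′ ∷ m₂) t (z ∷ []))))

  BallotFrom : ℕ → ℕ → List Step → Set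
  BallotFrom α β [] = α ≤ β
  BallotFrom α β (u ∷ w) = α ≤ β × BallotFrom α (suc β) w
  BallotFrom α β (r ∷ w) = α ≤ β × BallotFrom (suc α) β w

  all-map : ∀ {A B : Set} (f : B → Bool) (g : A → B) xs → all f (map g xs) ≡ all (f ∘ g) xs
  all-map f g [] = refl
  all-map f g (x ∷ xs) = cong (f (g x) ∧_) (all-map f g xs)

  all-cong : ∀ {A : Set} {f g : A → Bool} xs → (∀ x → f x ≡ g x) → all f xs ≡ all g xs
  all-cong [] eq = refl
  all-cong (x ∷ xs) eq = cong₂ _∧_ (eq x) (all-cong xs eq)

  -- The Boolean form of BallotFrom; isBallot w is ballotFrom 0 0 w.
  ballotFrom : ℕ → ℕ → List Step → Bool
  ballotFrom α β w = all (λ q → (α + #r q) ℕ.≤ᵇ (β + #u q)) (inits w)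

  ballotFrom-u : ∀ α β w → ballotFrom α β (u ∷ w) ≡ ((α + 0) ℕ.≤ᵇ (β + 0)) ∧ ballotFrom α (suc β) w
  ballotFrom-u α β w = cong (((α + 0) ℕ.≤ᵇ (β + 0)) ∧_) (trans (all-map _ (u ∷_) (inits w)) (all-cong (inits w) (λ q → cong ((α + #r q) ℕ.≤ᵇ_) (ℕP.+-suc β (#u q)))))

  ballotFrom-r : ∀ α β w → ballotFrom α β (r ∷ w) ≡ ((α + 0) ℕ.≤ᵇ (β + 0)) ∧ ballotFrom (suc α) β w
  ballotFrom-r α β w = cong (((α + 0) ℕ.≤ᵇ (β + 0)) ∧_) (trans (all-map _ (r ∷_) (inits w)) (all-cong (inits w) (λ q → cong (ℕ._≤ᵇ (β + #u q)) (ℕP.+-suc α (#r q)))))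

  +0-≤⁻ : ∀ {α β} → α + 0 ≤ β + 0 → α ≤ β
  +0-≤⁻ {α} {β} h = subst₂ _≤_ (ℕP.+-identityʳ α) (ℕP.+-identityʳ β) h

  +0-≤⁺ : ∀ {α β} → α ≤ β → α + 0 ≤ β + 0
  +0-≤⁺ {α} {β} h = subst₂ _≤_ (sym (ℕP.+-identityʳ α)) (sym (ℕP.+-identityʳ β)) h

  ballotFrom-sound : ∀ α β w → T (ballotFrom α β w) → BallotFrom α β w
  ballotFrom-sound α β [] t = +0-≤⁻ (ℕP.≤ᵇ⇒≤ _ _ (proj₁ (T∧ t)))
  ballotFrom-sound α β (u ∷ w) t with T∧ (subst T (ballotFrom-u α β w) t)
  ... | a , b = +0-≤⁻ (ℕP.≤ᵇ⇒≤ _ _ a) , ballotFrom-sound α (suc β) w b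
  ballotFrom-sound α β (r ∷ w) t with T∧ (subst T (ballotFrom-r α β w) t)
  ... | a , b = +0-≤⁻ (ℕP.≤ᵇ⇒≤ _ _ a) , ballotFrom-sound (suc α) β w b

  ballotFrom-complete : ∀ α β w → BallotFrom α β w → T (ballotFrom α β w)
  ballotFrom-complete α β [] h = ∧T (ℕP.≤⇒≤ᵇ (+0-≤⁺ h)) tt
  ballotFrom-complete α β (u ∷ w) (a , b) = subst T (sym (ballotFrom-u α β w)) (∧T (ℕP.≤⇒≤ᵇ (+0-≤⁺ a)) (ballotFrom-complete α (suc β) w b))
  ballotFrom-complete α β (r ∷ w) (a , b) = subst T (sym (ballotFrom-r α β w)) (∧T (ℕP.≤⇒≤ᵇ (+0-≤⁺ a)) (ballotFrom-complete (suc α) β w b))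

  ballot-start : ∀ α β s → BallotFrom α β s → α ≤ β
  ballot-start α β [] h = h
  ballot-start α β (u ∷ s) h = proj₁ h
  ballot-start α β (r ∷ s) h = proj₁ h

  ballot-++⁻ : ∀ α β v s → BallotFrom α β (v ++ s) → BallotFrom α β v × BallotFrom (α + #r v) (β + #u v) s
  ballot-++⁻ α β [] s h = ballot-start α β s h , subst₂ (λ x y → BallotFrom x y s) (sym (ℕP.+-identityʳ α)) (sym (ℕP.+-identityʳ β)) h
  ballot-++⁻ α β (u ∷ v) s (a , b) with ballot-++⁻ α (suc β) v s b
  ... | c , d = (a , c) , subst (λ y → BallotFrom (α + #r v) y s) (sym (ℕP.+-suc β (#u v))) d
  ballot-++⁻ α β (r ∷ v) s (a , b) with ballot-++⁻ (suc α) β v s b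
  ... | c , d = (a , c) , subst (λ x → BallotFrom x (β + #u v) s) (sym (ℕP.+-suc α (#r v))) d

  ballot-++⁺ : ∀ α β v s → BallotFrom α β v → BallotFrom (α + #r v) (β + #u v) s → BallotFrom α β (v ++ s)
  ballot-++⁺ α β [] s h k = subst₂ (λ x y → BallotFrom x y s) (ℕP.+-identityʳ α) (ℕP.+-identityʳ β) k
  ballot-++⁺ α β (u ∷ v) s (a , b) k = a , ballot-++⁺ α (suc β) v s b (subst (λ y → BallotFrom (α + #r v) y s) (ℕP.+-suc β (#u v)) k)
  ballot-++⁺ α β (r ∷ v) s (a , b) k = a , ballot-++⁺ (suc α) β v s b (subst (λ x → BallotFrom x (β + #u v) s) (ℕP.+-suc α (#r v)) k)

  ballot-end : ∀ α β w → BallotFrom α β w → α + #r w ≤ β + #u w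
  ballot-end α β [] h = +0-≤⁺ h
  ballot-end α β (u ∷ w) (a , b) = subst (α + #r w ≤_) (sym (ℕP.+-suc β (#u w))) (ballot-end α (suc β) w b)
  ballot-end α β (r ∷ w) (a , b) = subst (_≤ β + #u w) (sym (ℕP.+-suc α (#r w))) (ballot-end (suc α) β w b)

  -- Every nonempty suffix has at least as many r's as u's, i.e. depth ≤ 0.
  Depth≤0 : List Step → Set
  Depth≤0 [] = ⊤
  Depth≤0 (s ∷ w) = #u (s ∷ w) ≤ #r (s ∷ w) × Depth≤0 w

  cancel-≤ : ∀ x y A B → x + A ≤ y + B → B ≤ A → x ≤ y
  cancel-≤ x y A B h BA = ℕP.+-cancelʳ-≤ A x y (ℕP.≤-trans h (ℕP.+-monoʳ-≤ y BA))

  -- A pattern of depth ≤ 0 can be appended to a ballot word as soon as its end point is on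
  -- the right side of the diagonal: its suffixes never bring the path lower than its end.
  ballot-depth≤0 : ∀ x y p → Depth≤0 p → x + #r p ≤ y + #u p → BallotFrom x y p
  ballot-depth≤0 x y [] _ h = +0-≤⁻ h
  ballot-depth≤0 x y (u ∷ p) (d , dk) h = cancel-≤ x y _ _ h d , ballot-depth≤0 x (suc y) p dk (subst (x + #r p ≤_) (ℕP.+-suc y (#u p)) h)
  ballot-depth≤0 x y (r ∷ p) (d , dk) h = cancel-≤ x y _ _ h d , ballot-depth≤0 (suc x) y p dk (subst (_≤ y + #u p) (ℕP.+-suc x (#r p)) h)

  d≤0⇒ : ∀ a b → (ℤ.+ a) ℤ.- (ℤ.+ b) ℤ.≤ ℤ.+ 0 → a ≤ b
  d≤0⇒ a b h = ℤP.drop‿+≤+ (subst₂ ℤ._≤_ (cancel (ℤ.+ a) (ℤ.+ b)) (ℤP.+-identityˡ (ℤ.+ b)) (ℤP.+-monoˡ-≤ (ℤ.+ b) h))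
    where
    cancel : ∀ x y → x ℤ.- y ℤ.+ y ≡ x
    cancel = solve-∀

  depth≤0 : ∀ p → depth p ℤ.≤ ℤ.+ 0 → Depth≤0 p
  depth≤0 [] _ = tt
  depth≤0 (x ∷ w) h = d≤0⇒ _ _ (ℤP.i⊔j≤k⇒i≤k (d (x ∷ w)) (depth w) h) , depth≤0 w (ℤP.i⊔j≤k⇒j≤k (d (x ∷ w)) (depth w) h)

  #r-++ : ∀ v s → #r (v ++ s) ≡ #r v + #r s
  #r-++ [] s = refl
  #r-++ (u ∷ v) s = #r-++ v s
  #r-++ (r ∷ v) s = cong suc (#r-++ v s)

  #u-++ : ∀ v s → #u (v ++ s) ≡ #u v + #u s
  #u-++ [] s = refl
  #u-++ (u ∷ v) s = cong suc (#u-++ v s)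
  #u-++ (r ∷ v) s = #u-++ v s

  length-#r+#u : ∀ w → length w ≡ #r w + #u w
  length-#r+#u [] = refl
  length-#r+#u (u ∷ w) = trans (cong suc (length-#r+#u w)) (sym (ℕP.+-suc (#r w) (#u w)))
  length-#r+#u (r ∷ w) = cong suc (length-#r+#u w)

  longer-suffix : ∀ (x : Step) m (s q : List Step) → s ≡ (x ∷ m) ++ q → length s ≡ length q → ⊥
  longer-suffix x m s q e ls = ℕP.<-irrefl refl (subst (length q <_) ls (subst (length q <_) (sym (cong length e))
     (subst (length q <_) (sym (LP.length-++ (x ∷ m))) (s≤s (ℕP.m≤n+m (length q) (length m))))))

  suffix-unique : ∀ (v s v' p : List Step) → v ++ s ≡ v' ++ p → length s ≡ length p → s ≡ p
  suffix-unique v s v' p e ls with ++-split v s v' p e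
  ... | inj₁ ([] , _ , s≡p) = s≡p
  ... | inj₁ (x ∷ m , _ , s≡xm++p) = ⊥-elim (longer-suffix x m s p s≡xm++p ls)
  ... | inj₂ ([] , _ , p≡s) = sym p≡s
  ... | inj₂ (x ∷ m , _ , p≡xm++s) = ⊥-elim (longer-suffix x m p s p≡xm++s (sym ls))

module PathCount where

  open import Defs
  open Words
  open Recurrence
  open import Data.Nat as ℕ using (ℕ; zero; suc; _+_; _∸_; _≤_; _<_; z≤n)
  import Data.Nat.Properties as ℕP
  open import Data.List using (List; []; _∷_; _++_; length)
  import Data.List.Properties as LP
  open import Data.Bool using (Bool; true; false; _∧_; not; T)
  open import Data.Unit using (tt)
  open import Data.Empty using (⊥-elim)
  open import Data.Product using (_×_; _,_; proj₁; proj₂)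
  open import Data.Sum using (inj₁; inj₂)
  open import Relation.Binary.PropositionalEquality
  open import Relation.Nullary using (¬_)
  open import Relation.Nullary.Decidable using (⌊_⌋)
  open import Data.Integer as ℤ using (+_)
  import Data.Integer.Properties as ℤP
  open import Data.Integer.Tactic.RingSolver using (solve-∀)

  module PatternCounting (p ip : List Step) (z : Step) (p≡ip∷z : p ≡ ip ++ z ∷ [])
                         (bifix-free : BifixFree p) (depth0 : Depth≤0 p) (c≤a : #u p ≤ #r p) where
    a = #r p
    c = #u p
    L = length p

    admissible : ℕ → ℕ → List Step → Bool
    admissible n m w = ⌊ (#r w ℕ.≟ n) ⌋ ∧ ⌊ (#u w ℕ.≟ m) ⌋ ∧ isBallot w ∧ avoids w p

    extends : Step → ℕ → ℕ → List Step → Bool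
    extends x n m w = ⌊ (#r (w ++ x ∷ []) ℕ.≟ n) ⌋ ∧ ⌊ (#u (w ++ x ∷ []) ℕ.≟ m) ⌋ ∧ isBallot (w ++ x ∷ []) ∧ avoids w p

    patternEnd : ℕ → ℕ → List Step → Bool
    patternEnd n m W = ⌊ (#r W ℕ.≟ n) ⌋ ∧ ⌊ (#u W ℕ.≟ m) ⌋ ∧ isBallot W ∧ (avoids (dropLast W) p ∧ endsWith p W)

    avoids-sound : ∀ w → T (avoids w p) → ¬ Factor p w
    avoids-sound w t to = Tnot t (containsFactor-complete p w to)

    avoids-complete : ∀ w → ¬ Factor p w → T (avoids w p)
    avoids-complete w nf = notT (λ t → nf (containsFactor-sound p w t))

    ballot-sound : ∀ w → T (isBallot w) → BallotFrom 0 0 w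
    ballot-sound w = ballotFrom-sound 0 0 w

    ballot-complete : ∀ w → BallotFrom 0 0 w → T (isBallot w)
    ballot-complete w = ballotFrom-complete 0 0 w

    admissible⁻ : ∀ n m w → T (admissible n m w) → T ⌊ (#r w ℕ.≟ n) ⌋ × T ⌊ (#u w ℕ.≟ m) ⌋ × T (isBallot w) × T (avoids w p)
    admissible⁻ n m w = T-∧₄⁻ {⌊ (#r w ℕ.≟ n) ⌋} {⌊ (#u w ℕ.≟ m) ⌋} {isBallot w} {avoids w p}

    admissible⁺ : ∀ n m w → T ⌊ (#r w ℕ.≟ n) ⌋ → T ⌊ (#u w ℕ.≟ m) ⌋ → T (isBallot w) → T (avoids w p) → T (admissible n m w)
    admissible⁺ n m w = T-∧₄⁺ {⌊ (#r w ℕ.≟ n) ⌋} {⌊ (#u w ℕ.≟ m) ⌋} {isBallot w} {avoids w p}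

    extends⁻ : ∀ x n m w → T (extends x n m w) → T ⌊ (#r (w ++ x ∷ []) ℕ.≟ n) ⌋ × T ⌊ (#u (w ++ x ∷ []) ℕ.≟ m) ⌋ × T (isBallot (w ++ x ∷ [])) × T (avoids w p)
    extends⁻ x n m w = T-∧₄⁻ {⌊ (#r (w ++ x ∷ []) ℕ.≟ n) ⌋} {⌊ (#u (w ++ x ∷ []) ℕ.≟ m) ⌋} {isBallot (w ++ x ∷ [])} {avoids w p}

    extends⁺ : ∀ x n m w → T ⌊ (#r (w ++ x ∷ []) ℕ.≟ n) ⌋ → T ⌊ (#u (w ++ x ∷ []) ℕ.≟ m) ⌋ → T (isBallot (w ++ x ∷ [])) → T (avoids w p) → T (extends x n m w)
    extends⁺ x n m w = T-∧₄⁺ {⌊ (#r (w ++ x ∷ []) ℕ.≟ n) ⌋} {⌊ (#u (w ++ x ∷ []) ℕ.≟ m) ⌋} {isBallot (w ++ x ∷ [])} {avoids w p}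

    patternEnd⁻ : ∀ n m W → T (patternEnd n m W) → T ⌊ (#r W ℕ.≟ n) ⌋ × T ⌊ (#u W ℕ.≟ m) ⌋ × T (isBallot W) × T (avoids (dropLast W) p ∧ endsWith p W)
    patternEnd⁻ n m W = T-∧₄⁻ {⌊ (#r W ℕ.≟ n) ⌋} {⌊ (#u W ℕ.≟ m) ⌋} {isBallot W} {avoids (dropLast W) p ∧ endsWith p W}

    patternEnd⁺ : ∀ n m W → T ⌊ (#r W ℕ.≟ n) ⌋ → T ⌊ (#u W ℕ.≟ m) ⌋ → T (isBallot W) → T (avoids (dropLast W) p ∧ endsWith p W) → T (patternEnd n m W)
    patternEnd⁺ n m W = T-∧₄⁺ {⌊ (#r W ℕ.≟ n) ⌋} {⌊ (#u W ℕ.≟ m) ⌋} {isBallot W} {avoids (dropLast W) p ∧ endsWith p W}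

    extension-avoids : ∀ x n m w → (extends x n m w ∧ not (endsWith p (w ++ x ∷ []))) ≡ admissible n m (w ++ x ∷ [])
    extension-avoids x n m w = bool-ext to from
      where
      to : T (extends x n m w ∧ not (endsWith p (w ++ x ∷ []))) → T (admissible n m (w ++ x ∷ []))
      to t with T∧ {extends x n m w} t
      ... | t1 , t2 with extends⁻ x n m w t1
      ... | #r-ok , #u-ok , ballot , avoiding = admissible⁺ n m _ #r-ok #u-ok ballot (avoids-complete (w ++ x ∷ []) nf)
        where
        nf : ¬ Factor p (w ++ x ∷ [])
        nf fc with factor-of-snoc p w x fc
        ... | inj₁ fw = avoids-sound w avoiding fw
        ... | inj₂ sw = Tnot t2 (endsWith-complete p _ sw)
      from : T (admissible n m (w ++ x ∷ [])) → T (extends x n m w ∧ not (endsWith p (w ++ x ∷ [])))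
      from t with admissible⁻ n m _ t
      ... | #r-ok , #u-ok , ballot , avoiding = ∧T (extends⁺ x n m w #r-ok #u-ok ballot (avoids-complete w (λ fw → avoids-sound _ avoiding (factor-snoc p w x fw))))
                                   (notT (λ te → avoids-sound _ avoiding (suffix⇒factor p _ (endsWith-sound p _ te))))

    extension-hits : ∀ x n m w → (extends x n m w ∧ endsWith p (w ++ x ∷ [])) ≡ patternEnd n m (w ++ x ∷ [])
    extension-hits x n m w = bool-ext to from
      where
      to : T (extends x n m w ∧ endsWith p (w ++ x ∷ [])) → T (patternEnd n m (w ++ x ∷ []))
      to t with T∧ {extends x n m w} t
      ... | t1 , t2 with extends⁻ x n m w t1
      ... | #r-ok , #u-ok , ballot , avoiding = patternEnd⁺ n m _ #r-ok #u-ok ballot (∧T (subst (λ v → T (avoids v p)) (sym (dropLast-snoc w x)) avoiding) t2)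
      from : T (patternEnd n m (w ++ x ∷ [])) → T (extends x n m w ∧ endsWith p (w ++ x ∷ []))
      from t with patternEnd⁻ n m _ t
      ... | #r-ok , #u-ok , ballot , avoiding with T∧ {avoids (dropLast (w ++ x ∷ [])) p} avoiding
      ... | k1 , k2 = ∧T (extends⁺ x n m w #r-ok #u-ok ballot (subst (λ v → T (avoids v p)) (dropLast-snoc w x) k1)) k2

    extend-up : ∀ n m' w → extends u n (suc m') w ≡ admissible n m' w
    extend-up n m' w = bool-ext to from
      where
      to : T (extends u n (suc m') w) → T (admissible n m' w)
      to t with extends⁻ u n (suc m') w t
      ... | #r-ok , #u-ok , ballot , avoiding = admissible⁺ n m' w (≟-complete (trans (sym (trans (#r-++ w (u ∷ [])) (ℕP.+-identityʳ _))) (≟-sound #r-ok)))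
                                    (≟-complete (ℕP.suc-injective (trans (sym (trans (#u-++ w (u ∷ [])) (ℕP.+-comm (#u w) 1))) (≟-sound #u-ok))))
                                    (ballot-complete w (proj₁ (ballot-++⁻ 0 0 w (u ∷ []) (ballot-sound _ ballot)))) avoiding
      from : T (admissible n m' w) → T (extends u n (suc m') w)
      from t with admissible⁻ n m' w t
      ... | #r-ok , #u-ok , ballot , avoiding = extends⁺ u n (suc m') w (≟-complete (trans (trans (#r-++ w (u ∷ [])) (ℕP.+-identityʳ _)) (≟-sound #r-ok)))
                                    (≟-complete (trans (trans (#u-++ w (u ∷ [])) (ℕP.+-comm (#u w) 1)) (cong suc (≟-sound #u-ok))))
                                    (ballot-complete _ (ballot-++⁺ 0 0 w (u ∷ []) (ballot-sound w ballot) (fl , ℕP.m≤n⇒m≤1+n fl))) avoiding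
        where fl = ballot-end 0 0 w (ballot-sound w ballot)

    extend-right : ∀ n' m w → suc n' ≤ m → extends r (suc n') m w ≡ admissible n' m w
    extend-right n' m w le = bool-ext to from
      where
      to : T (extends r (suc n') m w) → T (admissible n' m w)
      to t with extends⁻ r (suc n') m w t
      ... | #r-ok , #u-ok , ballot , avoiding = admissible⁺ n' m w (≟-complete (ℕP.suc-injective (trans (sym (trans (#r-++ w (r ∷ [])) (ℕP.+-comm (#r w) 1))) (≟-sound #r-ok))))
                                    (≟-complete (trans (sym (trans (#u-++ w (r ∷ [])) (ℕP.+-identityʳ _))) (≟-sound #u-ok)))
                                    (ballot-complete w (proj₁ (ballot-++⁻ 0 0 w (r ∷ []) (ballot-sound _ ballot)))) avoiding
      from : T (admissible n' m w) → T (extends r (suc n') m w)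
      from t with admissible⁻ n' m w t
      ... | #r-ok , #u-ok , ballot , avoiding = extends⁺ r (suc n') m w (≟-complete (trans (trans (#r-++ w (r ∷ [])) (ℕP.+-comm (#r w) 1)) (cong suc (≟-sound #r-ok))))
                                    (≟-complete (trans (trans (#u-++ w (r ∷ [])) (ℕP.+-identityʳ _)) (≟-sound #u-ok)))
                                    (ballot-complete _ (ballot-++⁺ 0 0 w (r ∷ []) (ballot-sound w ballot) (ℕP.<⇒≤ lt , lt))) avoiding
        where
        lt : suc (#r w) ≤ #u w
        lt = subst₂ (λ x y → suc x ≤ y) (sym (≟-sound #r-ok)) (sym (≟-sound #u-ok)) le

    extend-right-origin : ∀ m w → extends r 0 m w ≡ false
    extend-right-origin m w = bool-ext to (λ ())
      where
      to : T (extends r 0 m w) → T false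
      to t with extends⁻ r 0 m w t
      ... | #r-ok , _ = ⊥-elim (ℕP.0≢1+n (sym (trans (sym (trans (#r-++ w (r ∷ [])) (ℕP.+-comm (#r w) 1))) (≟-sound #r-ok))))

    factor-++ : ∀ v w → Factor p v → Factor p (v ++ w)
    factor-++ v w (A , t , refl) = A , t ++ w , trans (LP.++-assoc A (p ++ t) w) (cong (A ++_) (LP.++-assoc p t w))

    dropLast-pattern : ∀ v → dropLast (v ++ p) ≡ v ++ ip
    dropLast-pattern v = trans (cong (λ q → dropLast (v ++ q)) p≡ip∷z) (trans (cong dropLast (sym (LP.++-assoc v ip (z ∷ [])))) (dropLast-snoc (v ++ ip) z))

    patternEnd-other : ∀ n m v s → length s ≡ L → ¬ s ≡ p → patternEnd n m (v ++ s) ≡ false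
    patternEnd-other n m v s ls ne = bool-ext to (λ ())
      where
      to : T (patternEnd n m (v ++ s)) → T false
      to t with patternEnd⁻ n m _ t
      ... | _ , _ , _ , avoiding with endsWith-sound p _ (proj₂ (T∧ {avoids (dropLast (v ++ s)) p} avoiding))
      ... | v' , e = ne (suffix-unique v s v' p e ls)

    -- Removing the final p gives a bijection with admissible words ending at
    -- (n-a,m-c): the prefix v stays admissible, and conversely v ++ p is a ballot
    -- word (depth ≤ 0) whose only occurrence of p is the last one (bifix-free).
    patternEnd-pattern : ∀ n m v → a ≤ n → n ≤ m → patternEnd n m (v ++ p) ≡ admissible (n ∸ a) (m ∸ c) v
    patternEnd-pattern n m v a≤n n≤m = bool-ext to from
      where
      c≤m : c ≤ m
      c≤m = ℕP.≤-trans c≤a (ℕP.≤-trans a≤n n≤m)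
      to : T (patternEnd n m (v ++ p)) → T (admissible (n ∸ a) (m ∸ c) v)
      to t with patternEnd⁻ n m _ t
      ... | #r-ok , #u-ok , ballot , avoiding = admissible⁺ _ _ v
            (≟-complete (trans (sym (ℕP.m+n∸n≡m (#r v) a)) (cong (_∸ a) (trans (sym (#r-++ v p)) (≟-sound #r-ok)))))
            (≟-complete (trans (sym (ℕP.m+n∸n≡m (#u v) c)) (cong (_∸ c) (trans (sym (#u-++ v p)) (≟-sound #u-ok)))))
            (ballot-complete v (proj₁ (ballot-++⁻ 0 0 v p (ballot-sound _ ballot))))
            (avoids-complete v (λ fv → avoids-sound _ (subst (λ q → T (avoids q p)) (dropLast-pattern v) (proj₁ (T∧ {avoids (dropLast (v ++ p)) p} avoiding))) (factor-++ v ip fv)))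
      from : T (admissible (n ∸ a) (m ∸ c) v) → T (patternEnd n m (v ++ p))
      from t with admissible⁻ _ _ v t
      ... | #r-ok , #u-ok , ballot , avoiding = patternEnd⁺ n m _
            (≟-complete (trans (#r-++ v p) (trans (cong (_+ a) (≟-sound #r-ok)) (ℕP.m∸n+n≡m a≤n))))
            (≟-complete (trans (#u-++ v p) (trans (cong (_+ c) (≟-sound #u-ok)) (ℕP.m∸n+n≡m c≤m))))
            (ballot-complete _ (ballot-++⁺ 0 0 v p (ballot-sound v ballot) (ballot-depth≤0 (#r v) (#u v) p depth0 ineq)))
            (∧T (subst (λ q → T (avoids q p)) (sym (dropLast-pattern v)) (avoids-complete (v ++ ip) (bifix-extension p ip z bifix-free p≡ip∷z v (avoids-sound v avoiding)))) (endsWith-at p v))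
        where
        ineq : #r v + a ≤ #u v + c
        ineq = subst₂ _≤_ (sym (trans (cong (_+ a) (≟-sound #r-ok)) (ℕP.m∸n+n≡m a≤n))) (sym (trans (cong (_+ c) (≟-sound #u-ok)) (ℕP.m∸n+n≡m c≤m))) n≤m

    patternEnd-short : ∀ n m W → n < a → patternEnd n m W ≡ false
    patternEnd-short n m W lt = bool-ext to (λ ())
      where
      to : T (patternEnd n m W) → T false
      to t with patternEnd⁻ n m _ t
      ... | #r-ok , _ , _ , avoiding with endsWith-sound p _ (proj₂ (T∧ {avoids (dropLast W) p} avoiding))
      ... | v , e = ℕP.<-irrefl refl (ℕP.<-≤-trans lt (subst (a ≤_) (trans (sym (#r-++ v p)) (trans (cong #r (sym e)) (≟-sound #r-ok))) (ℕP.m≤n+m a (#r v))))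

    admissible-below-diagonal : ∀ n m w → m < n → admissible n m w ≡ false
    admissible-below-diagonal n m w lt = bool-ext to (λ ())
      where
      to : T (admissible n m w) → T false
      to t with admissible⁻ n m w t
      ... | #r-ok , #u-ok , ballot , _ = ℕP.<-irrefl refl (ℕP.<-≤-trans lt (subst₂ _≤_ (≟-sound #r-ok) (≟-sound #u-ok) (ballot-end 0 0 w (ballot-sound w ballot))))

    countWords-snoc : ∀ k P → countWords (k + 1) P ≡ countWords k (λ w → P (w ++ u ∷ [])) + countWords k (λ w → P (w ++ r ∷ []))
    countWords-snoc k P = trans (countWords-++ k 1 P) (cong (λ t → countWords k (λ w → P (w ++ u ∷ [])) + t) (ℕP.+-identityʳ _))

    patternEnds : ℕ → ℕ → ℕ
    patternEnds n m = countWords (n + m) (patternEnd n m)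

    leftCount : ℕ → ℕ → ℕ
    leftCount zero m = 0
    leftCount (suc n') m = countPaths p n' m

    split-extends : ∀ x n m k → countWords k (extends x n m) ≡ countWords k (λ w → admissible n m (w ++ x ∷ [])) + countWords k (λ w → patternEnd n m (w ++ x ∷ []))
    split-extends x n m k = trans (count-split (words k) (extends x n m) (λ w → endsWith p (w ++ x ∷ [])))
      (cong₂ _+_ (count-cong (words k) (extension-avoids x n m)) (count-cong (words k) (extension-hits x n m)))

    count-recurrence : ∀ n m' → n ≤ suc m' → countPaths p n (suc m') + patternEnds n (suc m') ≡ countPaths p n m' + leftCount n (suc m')
    count-recurrence n m' n≤m+1 = begin
        countWords (n + suc m') (admissible n (suc m')) + countWords (n + suc m') (patternEnd n (suc m'))
          ≡⟨ cong (λ q → countWords q (admissible n (suc m')) + countWords q (patternEnd n (suc m'))) length-split ⟩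
        countWords (k + 1) (admissible n (suc m')) + countWords (k + 1) (patternEnd n (suc m'))
          ≡⟨ cong₂ _+_ (countWords-snoc k (admissible n (suc m'))) (countWords-snoc k (patternEnd n (suc m'))) ⟩
        (avoiding-after u + avoiding-after r) + (hitting-after u + hitting-after r)
          ≡⟨ +-interchange (avoiding-after u) (avoiding-after r) (hitting-after u) (hitting-after r) ⟩
        (avoiding-after u + hitting-after u) + (avoiding-after r + hitting-after r)
          ≡⟨ cong₂ _+_ (sym (split-extends u n (suc m') k)) (sym (split-extends r n (suc m') k)) ⟩
        countWords k (extends u n (suc m')) + countWords k (extends r n (suc m'))
          ≡⟨ cong₂ _+_ (count-cong (words k) (extend-up n m')) (extend-right-count n n≤m+1) ⟩
        countPaths p n m' + leftCount n (suc m') ∎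
      where
      open ≡-Reasoning
      k = n + m'
      avoiding-after hitting-after : Step → ℕ
      avoiding-after x = countWords k (λ w → admissible n (suc m') (w ++ x ∷ []))
      hitting-after x = countWords k (λ w → patternEnd n (suc m') (w ++ x ∷ []))
      length-split : n + suc m' ≡ k + 1
      length-split = trans (ℕP.+-suc n m') (ℕP.+-comm 1 k)
      extend-right-count : ∀ n → n ≤ suc m' → countWords (n + m') (extends r n (suc m')) ≡ leftCount n (suc m')
      extend-right-count zero _ = count-none (words (0 + m')) _ (extend-right-origin (suc m'))
      extend-right-count (suc n') le' = trans (count-cong (words (suc n' + m')) (λ w → extend-right n' (suc m') w le')) (cong (λ q → countWords q (admissible n' (suc m'))) (sym (ℕP.+-suc n' m')))

    patternEnds-long : ∀ n m → a ≤ n → n ≤ m → patternEnds n m ≡ countPaths p (n ∸ a) (m ∸ c)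
    patternEnds-long n m a≤n n≤m =
      trans (cong (λ q → countWords q (patternEnd n m)) length-split)
      (trans (countWords-++ j L (patternEnd n m))
      (trans (sumWords-single L p _ refl (λ s ls ne → count-none (words j) _ (λ v → patternEnd-other n m v s ls ne)))
      (count-cong (words j) (λ v → patternEnd-pattern n m v a≤n n≤m))))
      where
      j = (n ∸ a) + (m ∸ c)
      c≤m : c ≤ m
      c≤m = ℕP.≤-trans c≤a (ℕP.≤-trans a≤n n≤m)
      length-split : n + m ≡ j + L
      length-split = sym (trans (cong (λ t → j + t) (length-#r+#u p)) (trans (+-interchange (n ∸ a) (m ∸ c) a c) (cong₂ _+_ (ℕP.m∸n+n≡m a≤n) (ℕP.m∸n+n≡m c≤m))))

    patternEnds-short : ∀ n m → n < a → patternEnds n m ≡ 0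
    patternEnds-short n m lt = count-none (words (n + m)) _ (λ W → patternEnd-short n m W lt)

    count-below-diagonal : ∀ n m → m < n → countPaths p n m ≡ 0
    count-below-diagonal n m lt = count-none (words (n + m)) _ (λ w → admissible-below-diagonal n m w lt)

    empty-admissible : admissible 0 0 [] ≡ true
    empty-admissible = bool-ext (λ _ → tt) (λ _ → admissible⁺ 0 0 [] tt tt (ballot-complete [] z≤n) (avoids-complete [] no-occurrence))
      where
      no-occurrence : ¬ Factor p []
      no-occurrence (A , t , []≡A++p++t) with LP.++-conicalʳ A (p ++ t) (sym []≡A++p++t)
      ... | p++t≡[] with LP.++-conicalˡ p t p++t≡[]
      ... | p≡[] with LP.++-conicalʳ ip (z ∷ []) (trans (sym p≡ip∷z) p≡[])
      ... | ()

    count-origin : countPaths p 0 0 ≡ 1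
    count-origin with admissible 0 0 [] | empty-admissible
    ... | .true | refl = refl

    countPaths-recurrence : BallotRecurrence a c (λ n m → + countPaths p n m)
    countPaths-recurrence = record
      { origin = cong +_ count-origin
      ; below-diagonal = λ k → cong +_ (count-below-diagonal (suc k) k (ℕP.n<1+n k))
      ; step-short = λ n m n≤m+1 n<a →
          trans (in-ℤ {y = countPaths p n m} {l = leftCount n (suc m)} (trans (cong (λ t → countPaths p n (suc m) + t) (sym (patternEnds-short n (suc m) n<a))) (count-recurrence n m n≤m+1)))
                (cong (λ l → + countPaths p n m ℤ.+ l) (left-in-ℤ n (suc m)))
      ; step-long = λ n m n≤m+1 a≤n →
          trans (in-ℤ′ {y = countPaths p n m} {l = leftCount n (suc m)} (trans (cong (λ t → countPaths p n (suc m) + t) (sym (patternEnds-long n (suc m) a≤n n≤m+1))) (count-recurrence n m n≤m+1)))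
                (cong (λ l → + countPaths p n m ℤ.+ l ℤ.- + countPaths p (n ∸ a) (suc m ∸ c)) (left-in-ℤ n (suc m)))
      }
      where
      left-in-ℤ : ∀ n m → + leftCount n m ≡ left (λ n m → + countPaths p n m) n m
      left-in-ℤ zero m = refl
      left-in-ℤ (suc n) m = refl
      in-ℤ : ∀ {x y l} → x + 0 ≡ y + l → + x ≡ + y ℤ.+ + l
      in-ℤ {x} {y} {l} x+0≡y+l = trans (cong +_ (sym (ℕP.+-identityʳ x))) (trans (cong +_ x+0≡y+l) (ℤP.pos-+ y l))
      in-ℤ′ : ∀ {x t y l} → x + t ≡ y + l → + x ≡ + y ℤ.+ + l ℤ.- + t
      in-ℤ′ {x} {t} {y} {l} x+t≡y+l = begin
          + x                          ≡⟨ cancel (+ x) (+ t) ⟩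
          (+ x ℤ.+ + t) ℤ.- + t        ≡⟨ cong (ℤ._- + t) (sym (ℤP.pos-+ x t)) ⟩
          + (x + t) ℤ.- + t            ≡⟨ cong (λ s → + s ℤ.- + t) x+t≡y+l ⟩
          + (y + l) ℤ.- + t            ≡⟨ cong (ℤ._- + t) (ℤP.pos-+ y l) ⟩
          + y ℤ.+ + l ℤ.- + t          ∎
        where
        open ≡-Reasoning
        cancel : ∀ x t → x ≡ (x ℤ.+ t) ℤ.- t
        cancel = solve-∀

open Recurrence
open ClosedForm
open Formula
open Words using (depth≤0)
open PathCount

open import Defs
open import Data.List using (List; []; _∷_; _++_)
open import Data.Nat using (ℕ; _≤_)
import Data.Nat as ℕ
import Data.Nat.Properties as ℕP
open import Data.Integer using (+_)
import Data.Integer.Properties as ℤP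
open import Data.Rational using (_/_)
import Data.Rational as ℚ
import Data.Rational.Properties as ℚP
open import Data.Product using (_×_; _,_; ∃)
open import Relation.Binary.PropositionalEquality using (_≡_; refl; cong; sym; trans; subst; module ≡-Reasoning)
open import Relation.Nullary using (¬_)
open import Data.Empty using (⊥-elim)

snoc-view : ∀ (p : List Step) → ¬ p ≡ [] → ∃ λ ip → ∃ λ z → p ≡ ip ++ z ∷ []
snoc-view [] p≢[] = ⊥-elim (p≢[] refl)
snoc-view (x ∷ []) _ = [] , x , refl
snoc-view (x ∷ y ∷ w) _ with snoc-view (y ∷ w) (λ ())
... | ip , z , e = x ∷ ip , z , cong (x ∷_) e

countPaths≡formula : ∀ p ip z → p ≡ ip ++ z ∷ [] → BifixFree p → depth p ≡ + 0 → #u p ≤ #r p → 2 ≤ #r p →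
  ∀ m n → n ≤ m → (+ countPaths p n m) / 1 ≡ formula (#r p) (#u p) n m
countPaths≡formula p ip z p≡ip∷z bifix-free depth0 c≤a 2≤a m n n≤m = begin
    (+ countPaths p n m) / 1  ≡⟨ cong (_/ 1) counts≡closedForm ⟩
    closedForm n m / 1        ≡⟨ sym (formula≡closedForm n m 2≤a c≤a n≤m) ⟩
    formula a c n m           ∎
  where
  open ≡-Reasoning
  a = #r p
  c = #u p
  open AlternatingSum a c using (closedForm; closedForm-recurrence)
  open Agreement a c using (formula≡closedForm)
  open PatternCounting p ip z p≡ip∷z bifix-free (depth≤0 p (ℤP.≤-reflexive depth0)) c≤a
    using (countPaths-recurrence)
  1≤a : 1 ≤ a
  1≤a = ℕP.≤-trans (ℕ.s≤s ℕ.z≤n) 2≤a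
  counts≡closedForm : + countPaths p n m ≡ closedForm n m
  counts≡closedForm = recurrence-unique 1≤a c≤a countPaths-recurrence (closedForm-recurrence 1≤a c≤a) n m n≤m

formula-diagonal : ∀ a c n → formula a c n n ≡ formulaDiag a c n
formula-diagonal a c n =
  trans (cong (λ k → ((+ (k ℕ.+ 1)) / 1) ℚ.* formulaDiag a c n) (ℕP.n∸n≡0 n)) (ℚP.*-identityˡ _)

mainTheorem4 : (p : List Step) (a c : ℕ) →
    BifixFree p → depth p ≡ + 0 → #r p ≡ a → #u p ≡ c →
    c ≤ a → 1 ≤ c → 2 ≤ a →
    ((m n : ℕ) → n ≤ m → (+ countPaths p n m) / 1 ≡ formula a c n m)
    × ((n : ℕ) → (+ countPaths p n n) / 1 ≡ formulaDiag a c n)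
mainTheorem4 p _ _ bifix-free depth0 refl refl c≤a _ 2≤a = general , diagonal
  where
  p≢[] : ¬ p ≡ []
  p≢[] p≡[] = ℕP.<-irrefl refl (ℕP.<-≤-trans (ℕ.s≤s ℕ.z≤n) (subst (λ q → 2 ≤ #r q) p≡[] 2≤a))
  general : ∀ m n → n ≤ m → (+ countPaths p n m) / 1 ≡ formula (#r p) (#u p) n m
  general with snoc-view p p≢[]
  ... | ip , z , p≡ip∷z = countPaths≡formula p ip z p≡ip∷z bifix-free depth0 c≤a 2≤a
  diagonal : ∀ n → (+ countPaths p n n) / 1 ≡ formulaDiag (#r p) (#u p) n
  diagonal n = trans (general n n ℕP.≤-refl) (formula-diagonal (#r p) (#u p) n)
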